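{- Let $(G,+)$ be a finite abelian group, $n$ a positive integer, $W=G\wr S_n$, and let $(\sigma,\rho)$ and $(\tau,\pi)$ be two double partitions of size $n$ satisfying $|\sigma|=|\tau|$, $\sigma\trianglelefteq\tau$ and $\rho\trianglelefteq\pi$. Then every $(\sigma,\rho)$-transitive subset of $W$ is $(\tau,\pi)$-transitive.
   Context: $[n]=\{1,\dots,n\}$. $W=G\wr S_n$ consists of pairs $(g,\pi)$, $g\in G^n$, $\pi\in S_n$, with $(f,\pi)(g,\sigma)=(f+g^\pi,\pi\sigma)$, $g^\pi=(g_{\pi^{ -1}(1)},\dots,g_{\pi^{ -1}(n)})$. A nonempty subset $Y$ of a group acting on a finite set $\Omega$ is transitive on $\Omega$ if there is $c>0$ such that for all $a,b\in\Omega$ exactly $c$ elements $y\in Y$ satisfy $ya=b$. Partitions are weakly decreasing sequences of nonnegative integers with finite sum; $\lambda\trianglelefteq\mu$ means $\sum_{i\le m}\lambda_i\le\sum_{i\le m}\mu_i$ for all $m\ge1$. For a map $\underline\sigma$ from subgroups of $G$ to partitions with $\sum_U|\underline\sigma(U)|=n$, a $\underline\sigma$-tableau consists of, for each $U\le G$, the Young diagram of $\underline\sigma(U)$ with boxes filled by pairs $(c,i)$, $c\in G/U$, $i\in[n]$, all $i$ pairwise distinct; row-equivalence classes are $\underline\sigma$-tabloids; $W$ acts entrywise by $(g,\pi)\cdot(c,i)=(c+g_{\pi(i)},\pi(i))$. A double partition $(\sigma,\rho)$ of size $n$ is a pair of partitions with $|\sigma|+|\rho|=n$; if $|G|>1$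 it corresponds to $\underline\sigma$ with $\underline\sigma(\{0\})=\sigma$, $\underline\sigma(G)=\rho$, $\underline\sigma(U)=\emptyset$ otherwise; if $|G|=1$ only $(\sigma,\emptyset)$ occurs, corresponding to $\underline\sigma(G)=\sigma$. "$(\sigma,\rho)$-transitive" means transitive on the $\underline\sigma$-tabloids. -}

module Defs where

open import Data.Nat using (ℕ; zero; suc; _≤_; _<_; _≥_; _+_)
open import Data.Nat.ListAction using (sum)
open import Data.Fin using (Fin)
open import Data.Fin.Permutation using (Permutation′; _⟨$⟩ʳ_)
open import Data.List as List using (List; []; _∷_; take; length; lookup; concat; _++_)
open import Data.List.Relation.Unary.Linked using (Linked)
open import Data.List.Relation.Unary.AllPairs using (AllPairs)
open import Data.List.Relation.Unary.Unique.Propositional using (Unique)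
open import Data.List.Relation.Binary.Permutation.Propositional using (_↭_)
open import Data.Vec as Vec using (Vec)
open import Data.Product using (Σ; ∃; _×_; _,_; proj₁; proj₂)
open import Data.Unit using (⊤)
open import Relation.Nullary using (¬_)
open import Relation.Binary.PropositionalEquality using (_≡_; _≢_)

-- Partitions: weakly decreasing finite lists of naturals (trailing zeros
-- are allowed and harmless; they stand for the infinite zero tail).

IsPartition : List ℕ → Set
IsPartition p = Linked _≥_ p

size : List ℕ → ℕ
size = sum

_⊴_ : List ℕ → List ℕ → Set
p ⊴ q = ∀ (k : ℕ) → sum (take k p) ≤ sum (take k q)

IsDoublePartition : ℕ → List ℕ → List ℕ → Set
IsDoublePartition n σ ρ = IsPartition σ × IsPartition ρ × (size σ + size ρ ≡ n)

-- The finite abelian group G is Fin m with operation _⊕_ .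
-- Wreath product W = G ≀ S_n : pairs (g , π), g ∈ G^n, π ∈ S_n.

record Wreath (m n : ℕ) : Set where
  constructor ⟪_,_⟫
  field
    vec  : Fin n → Fin m
    perm : Permutation′ n
open Wreath public

_≈W_ : ∀ {m n} → Wreath m n → Wreath m n → Set
x ≈W y = (∀ i → vec x i ≡ vec y i) × (∀ i → perm x ⟨$⟩ʳ i ≡ perm y ⟨$⟩ʳ i)

IsSubsetList : ∀ {m n} → List (Wreath m n) → Set
IsSubsetList Y = AllPairs (λ x y → ¬ (x ≈W y)) Y

record Tableau (L : Set) (n : ℕ) (sh : List ℕ) : Set where
  constructor tab
  field
    row : (r : Fin (length sh)) → Vec (L × Fin n) (lookup sh r)
open Tableau public

indices : ∀ {L n sh} → Tableau L n sh → List (Fin n)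
indices t = concat (List.tabulate (λ r → List.map proj₂ (Vec.toList (row t r))))

-- row equivalence (tabloids = classes of this relation)
_∼row_ : ∀ {L n sh} → Tableau L n sh → Tableau L n sh → Set
t ∼row t' = ∀ r → Vec.toList (row t r) ↭ Vec.toList (row t' r)

-- For a double partition (σ , ρ): the σ-diagram is attached to the trivial
-- subgroup {0}, whose cosets G/{0} are identified with the elements of G;
-- the ρ-diagram is attached to G, with G/G = a single point (⊤).
DTableau : ℕ → ℕ → List ℕ → List ℕ → Set
DTableau m n σ ρ = Tableau (Fin m) n σ × Tableau ⊤ n ρ

ValidDT : ∀ {m n σ ρ} → DTableau m n σ ρ → Set
ValidDT (a , b) = Unique (indices a ++ indices b)

_∼DT_ : ∀ {m n σ ρ} → DTableau m n σ ρ → DTableau m n σ ρ → Set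
(a , b) ∼DT (a' , b') = (a ∼row a') × (b ∼row b')

actDT : ∀ {m n σ ρ} → (Fin m → Fin m → Fin m) →
        Wreath m n → DTableau m n σ ρ → DTableau m n σ ρ
actDT _⊕_ w (a , b) =
    tab (λ r → Vec.map (λ { (c , i) → (c ⊕ vec w (perm w ⟨$⟩ʳ i)) , perm w ⟨$⟩ʳ i }) (row a r))
  , tab (λ r → Vec.map (λ { (c , i) → c , perm w ⟨$⟩ʳ i }) (row b r))

data CountIs {A : Set} (P : A → Set) : List A → ℕ → Set where
  nil  : CountIs P [] 0
  here : ∀ {x xs c} → P x → CountIs P xs c → CountIs P (x ∷ xs) (suc c)
  skip : ∀ {x xs c} → ¬ P x → CountIs P xs c → CountIs P (x ∷ xs) c

-- Tabloids are represented by valid tableaux, equality of tabloids is ∼DT.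
Transitive : ∀ {m n} → (Fin m → Fin m → Fin m) → (σ ρ : List ℕ) →
             List (Wreath m n) → Set
Transitive {m} {n} _⊕_ σ ρ Y =
  (Y ≢ []) ×
  ∃ λ (c : ℕ) → (0 < c) ×
    (∀ (a b : DTableau m n σ ρ) → ValidDT a → ValidDT b →
       CountIs (λ y → actDT _⊕_ y a ∼DT b) Y c)

{-# OPTIONS --safe #-}
-- A (σ,ρ)-tabloid is the same as a map from [n] to cells (row, coset), and
-- transitivity says that for any two such maps of shape (σ,ρ) the number of
-- y ∈ Y carrying one to the other is a constant c > 0.  Dominance σ ⊴ τ is
-- generated by moves of one box from a row j up to a row i with λ_j ≤ λ_i, so
-- it suffices to treat one move, say to shape λ′ with λ′_j < λ′_i.  Fix maps
-- f, h of shape λ′ and let M be the entries that f puts in rows i and j, so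
-- |M| = λ′_i + λ′_j ≤ 2b + 1 where b = λ_i.  For A ⊆ M with |A| = b + 1 let f_A
-- put A in row i and M ∖ A in row j, and v(A) = #{y : y f_A = h}.  Moving the
-- image of the added entry back down shows, for every b-subset B of M, that
-- ∑_{A ⊃ B} v(A) = (b + 1) c.  The inclusion map between levels b + 1 and b of
-- the Boolean lattice of M is injective in this range (by the sl₂ relation
-- Σ↓Σ↑ − Σ↑Σ↓ = 2|A| − |M| and positivity), so v is constant, and
-- #{y : y f = h} = v(A₀) does not depend on f and h.

module Submission where

open import Defs
open import Data.Nat using (ℕ; _<_)
open import Data.Fin using (Fin)
open import Data.List using (List)
open import Data.Product using (_×_)
open import Algebra.Structures using (IsAbelianGroup)
open import Relation.Binary.PropositionalEquality using (_≡_)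

module Counting where

  open import Defs
  open import Data.Nat as ℕ using (ℕ; zero; suc; _+_; _*_; _≤_; z≤n; s≤s)
  import Data.Nat.Properties as ℕP
  open import Data.Fin using (Fin; zero; suc; punchIn)
  import Data.Fin.Properties as FinP
  open import Data.Fin.Permutation using (Permutation′; _⟨$⟩ʳ_)
  open import Data.List using (List; []; _∷_)
  open import Relation.Nullary using (¬_; Dec; yes; no; does; contradiction)
  open import Relation.Nullary.Decidable using (_×-dec_; _⊎-dec_)
  open import Data.Bool as Bool using (Bool; true; false; if_then_else_)
  open import Relation.Binary.PropositionalEquality
  open import Algebra.Properties.Semiring.Sum ℕP.+-*-semiring
    using (sum; sum-syntax; sum-cong-≗; sum-replicate-zero; sum-remove; ∑-distrib-+; sum-permute)

  𝟙 : ∀ {p} {P : Set p} → Dec P → ℕ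
  𝟙 (yes _) = 1
  𝟙 (no _)  = 0

  𝟙-yes : ∀ {p} {P : Set p} → P → (d : Dec P) → 𝟙 d ≡ 1
  𝟙-yes _ (yes _) = refl
  𝟙-yes x (no ¬x) = contradiction x ¬x

  𝟙-no : ∀ {p} {P : Set p} → ¬ P → (d : Dec P) → 𝟙 d ≡ 0
  𝟙-no ¬x (yes x) = contradiction x ¬x
  𝟙-no _  (no _)  = refl

  𝟙-cong : ∀ {p q} {P : Set p} {Q : Set q} → (P → Q) → (Q → P) → (d : Dec P) (e : Dec Q) → 𝟙 d ≡ 𝟙 e
  𝟙-cong f g (yes x) e = sym (𝟙-yes (f x) e)
  𝟙-cong f g (no ¬x) e = sym (𝟙-no (λ y → ¬x (g y)) e)

  𝟙≤1 : ∀ {p} {P : Set p} (d : Dec P) → 𝟙 d ≤ 1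
  𝟙≤1 (yes _) = s≤s z≤n
  𝟙≤1 (no _)  = z≤n

  𝟙-×-dec : ∀ {p q} {P : Set p} {Q : Set q} (d : Dec P) (e : Dec Q) → 𝟙 (d ×-dec e) ≡ 𝟙 d * 𝟙 e
  𝟙-×-dec (yes _) (yes _) = refl
  𝟙-×-dec (yes _) (no _)  = refl
  𝟙-×-dec (no _)  _       = refl

  does-true : ∀ {p} {P : Set p} (d : Dec P) → does d ≡ true → P
  does-true (yes x) _ = x

  does-false : ∀ {p} {P : Set p} (d : Dec P) → does d ≡ false → ¬ P
  does-false (no ¬x) _ = ¬x

  𝟙-≟true-* : ∀ b x → 𝟙 (b Bool.≟ true) * x ≡ (if b then x else 0)
  𝟙-≟true-* true  x = ℕP.*-identityˡ x
  𝟙-≟true-* false x = refl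

  if-does : ∀ {p} {P : Set p} (d : Dec P) → (if does d then 1 else 0) ≡ 𝟙 d
  if-does (yes _) = refl
  if-does (no _)  = refl

  𝟙-⊎-dec : ∀ {p q} {P : Set p} {Q : Set q} → (P → ¬ Q) → (d : Dec P) (e : Dec Q) → 𝟙 (d ⊎-dec e) ≡ 𝟙 d + 𝟙 e
  𝟙-⊎-dec P⇒¬Q (yes x) (yes y) = contradiction y (P⇒¬Q x)
  𝟙-⊎-dec P⇒¬Q (yes _) (no _)  = refl
  𝟙-⊎-dec P⇒¬Q (no _)  (yes _) = refl
  𝟙-⊎-dec P⇒¬Q (no _)  (no _)  = refl

  ∑-zero : ∀ {n} (f : Fin n → ℕ) → (∀ t → f t ≡ 0) → ∑[ t < n ] f t ≡ 0
  ∑-zero {n} f f≗0 = trans (sum-cong-≗ f≗0) (sum-replicate-zero n)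

  ∑-≤ : ∀ {n} (f : Fin n → ℕ) t → f t ≤ ∑[ t < n ] f t
  ∑-≤ f zero    = ℕP.m≤m+n (f zero) _
  ∑-≤ f (suc t) = ℕP.≤-trans (∑-≤ (λ t → f (suc t)) t) (ℕP.m≤n+m _ (f zero))

  ∑-update : ∀ {n} (f g : Fin n → ℕ) q → (∀ t → t ≢ q → f t ≡ g t) →
             ∑[ t < n ] f t + g q ≡ ∑[ t < n ] g t + f q
  ∑-update {suc n} f g q f≈g = begin
    sum f + g q                                       ≡⟨ cong (_+ g q) (sum-remove {i = q} f) ⟩
    f q + sum (λ t → f (punchIn q t)) + g q           ≡⟨ cong (λ s → f q + s + g q) rest ⟩
    f q + sum (λ t → g (punchIn q t)) + g q           ≡⟨ swap (f q) _ (g q) ⟩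
    g q + sum (λ t → g (punchIn q t)) + f q           ≡⟨ cong (_+ f q) (sum-remove {i = q} g) ⟨
    sum g + f q                                       ∎
    where
    open ≡-Reasoning
    rest : sum (λ t → f (punchIn q t)) ≡ sum (λ t → g (punchIn q t))
    rest = sum-cong-≗ (λ t → f≈g (punchIn q t) (FinP.punchInᵢ≢i q t))
    swap : ∀ a s b → a + s + b ≡ b + s + a
    swap a s b = trans (ℕP.+-comm (a + s) b) (trans (cong (b +_) (ℕP.+-comm a s)) (sym (ℕP.+-assoc b s a)))

  module _ {A : Set} where

    count : {P : A → Set} → (∀ y → Dec (P y)) → List A → ℕ
    count P? []       = 0
    count P? (y ∷ ys) = 𝟙 (P? y) + count P? ys

    CountIs⇒count≡ : ∀ {P : A → Set} (P? : ∀ y → Dec (P y)) {ys c} → CountIs P ys c → count P? ys ≡ c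
    CountIs⇒count≡ P? nil                     = refl
    CountIs⇒count≡ P? {y ∷ _} (here py c)  = cong₂ _+_ (𝟙-yes py (P? y)) (CountIs⇒count≡ P? c)
    CountIs⇒count≡ P? {y ∷ _} (skip ¬py c) = cong₂ _+_ (𝟙-no ¬py (P? y)) (CountIs⇒count≡ P? c)

    CountIs-count : ∀ {P : A → Set} (P? : ∀ y → Dec (P y)) ys → CountIs P ys (count P? ys)
    CountIs-count P? []       = nil
    CountIs-count P? (y ∷ ys) with P? y
    ... | yes py = here py (CountIs-count P? ys)
    ... | no ¬py = skip ¬py (CountIs-count P? ys)

    CountIs-cong : ∀ {P Q : A → Set} → (∀ y → P y → Q y) → (∀ y → Q y → P y) → ∀ {ys c} → CountIs P ys c → CountIs Q ys c
    CountIs-cong f g nil          = nil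
    CountIs-cong f g (here p c)   = here (f _ p) (CountIs-cong f g c)
    CountIs-cong f g (skip ¬p c)  = skip (λ q → ¬p (g _ q)) (CountIs-cong f g c)

    count-cong : ∀ {P Q : A → Set} (P? : ∀ y → Dec (P y)) (Q? : ∀ y → Dec (Q y)) →
                 (∀ y → P y → Q y) → (∀ y → Q y → P y) → ∀ ys → count P? ys ≡ count Q? ys
    count-cong P? Q? f g []       = refl
    count-cong P? Q? f g (y ∷ ys) = cong₂ _+_ (𝟙-cong (f y) (g y) (P? y) (Q? y)) (count-cong P? Q? f g ys)

    count-guard : ∀ {G : Set} {P : A → Set} (g : Dec G) (P? : ∀ y → Dec (P y)) ys →
                  count (λ y → g ×-dec P? y) ys ≡ 𝟙 g * count P? ys
    count-guard g P? []       = sym (ℕP.*-zeroʳ (𝟙 g))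
    count-guard g P? (y ∷ ys) = begin
      𝟙 (g ×-dec P? y) + count (λ y → g ×-dec P? y) ys ≡⟨ cong₂ _+_ (𝟙-×-dec g (P? y)) (count-guard g P? ys) ⟩
      𝟙 g * 𝟙 (P? y) + 𝟙 g * count P? ys               ≡⟨ ℕP.*-distribˡ-+ (𝟙 g) _ _ ⟨
      𝟙 g * (𝟙 (P? y) + count P? ys)                    ∎
      where open ≡-Reasoning

    ∑-count-permute : ∀ {k} {P Q : Fin k → A → Set} (P? : ∀ t y → Dec (P t y)) (Q? : ∀ q y → Dec (Q q y))
                      (π : A → Permutation′ k) → (∀ t y → P t y → Q (π y ⟨$⟩ʳ t) y) → (∀ t y → Q (π y ⟨$⟩ʳ t) y → P t y) →
                      ∀ ys → ∑[ t < k ] count (P? t) ys ≡ ∑[ q < k ] count (Q? q) ys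
    ∑-count-permute {k} P? Q? π f g [] = trans (∑-zero {k} _ (λ _ → refl)) (sym (∑-zero {k} _ (λ _ → refl)))
    ∑-count-permute {k} P? Q? π f g (y ∷ ys) = begin
      ∑[ t < k ] (𝟙 (P? t y) + count (P? t) ys)                  ≡⟨ ∑-distrib-+ (λ t → 𝟙 (P? t y)) _ ⟩
      ∑[ t < k ] 𝟙 (P? t y) + ∑[ t < k ] count (P? t) ys         ≡⟨ cong₂ _+_ here-y (∑-count-permute P? Q? π f g ys) ⟩
      ∑[ q < k ] 𝟙 (Q? q y) + ∑[ q < k ] count (Q? q) ys         ≡⟨ ∑-distrib-+ (λ q → 𝟙 (Q? q y)) _ ⟨
      ∑[ q < k ] (𝟙 (Q? q y) + count (Q? q) ys)                  ∎
      where
      open ≡-Reasoning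
      here-y : ∑[ t < k ] 𝟙 (P? t y) ≡ ∑[ q < k ] 𝟙 (Q? q y)
      here-y = trans (sum-cong-≗ (λ t → 𝟙-cong (f t y) (g t y) (P? t y) (Q? (π y ⟨$⟩ʳ t) y)))
                     (sym (sum-permute (λ q → 𝟙 (Q? q y)) (π y)))

module BooleanLattice where

  open import Data.Bool using (Bool; true; false; _∧_; _∨_; not; if_then_else_; T)
  open import Data.Vec using (Vec; []; _∷_; lookup; _[_]≔_)
  open import Data.Nat as ℕ using (ℕ; zero; suc; _∸_; _≤_)
  import Data.Nat.Properties as ℕP
  open import Data.Integer as ℤ using (ℤ; +_; -[1+_]; _+_; _*_; _-_; -_; 0ℤ; 1ℤ; ∣_∣)
  import Data.Integer.Properties as ℤP
  open import Data.Integer.Tactic.RingSolver using (solve-∀)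
  open import Data.Fin using (Fin; zero; suc)
  open import Data.Product using (_×_; _,_; proj₁; proj₂)
  open import Relation.Binary.PropositionalEquality
  open import Relation.Nullary.Decidable using (dec-true)
  import Algebra.Properties.Semiring.Sum as Sum

  private
    module ℕΣ = Sum ℕP.+-*-semiring
    module ℤΣ = Sum ℤP.+-*-semiring

  open ℕΣ using (sum-syntax)

  when : Bool → ℤ → ℤ
  when true  x = x
  when false _ = 0ℤ

  when-0ℤ : ∀ b → when b 0ℤ ≡ 0ℤ
  when-0ℤ true  = refl
  when-0ℤ false = refl

  when-+ : ∀ b x y → when b (x + y) ≡ when b x + when b y
  when-+ true  x y = refl
  when-+ false x y = refl

  when-* : ∀ b k x → when b (k * x) ≡ k * when b x
  when-* true  k x = refl
  when-* false k x = sym (ℤP.*-zeroʳ k)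

  sumAt : (Bool → Bool → Bool) → Bool → ∀ {n} → Vec Bool n → (Vec Bool n → ℤ) → Vec Bool n → ℤ
  sumAt φ y M w B = ℤΣ.sum (λ t → when (φ (lookup M t) (lookup B t)) (w (B [ t ]≔ y)))

  φ↑ φ↓ : Bool → Bool → Bool
  φ↑ m x = m ∧ not x
  φ↓ m x = m ∧ x

  -- Σ↑ M w B = ∑_{t ∈ M ∖ B} w (B ∪ {t})  and  Σ↓ M w A = ∑_{t ∈ M ∩ A} w (A ∖ {t})
  Σ↑ Σ↓ : ∀ {n} → Vec Bool n → (Vec Bool n → ℤ) → Vec Bool n → ℤ
  Σ↑ = sumAt φ↑ true
  Σ↓ = sumAt φ↓ false

  module _ (φ : Bool → Bool → Bool) (y : Bool) {n} (M : Vec Bool n) where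

    private
      summand : (Vec Bool n → ℤ) → Vec Bool n → Fin n → ℤ
      summand w B t = when (φ (lookup M t) (lookup B t)) (w (B [ t ]≔ y))

    sumAt-cong : ∀ {w w′ : Vec Bool n → ℤ} → (∀ A → w A ≡ w′ A) → ∀ B → sumAt φ y M w B ≡ sumAt φ y M w′ B
    sumAt-cong w≗w′ B = ℤΣ.sum-cong-≗ (λ t → cong (when _) (w≗w′ (B [ t ]≔ y)))

    sumAt-0+ : ∀ (w : Vec Bool n → ℤ) B → sumAt φ y M (λ A → 0ℤ + w A) B ≡ sumAt φ y M w B
    sumAt-0+ w = sumAt-cong (λ A → ℤP.+-identityˡ (w A))

    sumAt-+ : ∀ (v w : Vec Bool n → ℤ) B → sumAt φ y M (λ A → v A + w A) B ≡ sumAt φ y M v B + sumAt φ y M w B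
    sumAt-+ v w B = trans (ℤΣ.sum-cong-≗ (λ t → when-+ _ (v (B [ t ]≔ y)) (w (B [ t ]≔ y)))) (ℤΣ.∑-distrib-+ (summand v B) (summand w B))

    sumAt-* : ∀ k (w : Vec Bool n → ℤ) B → sumAt φ y M (λ A → k * w A) B ≡ k * sumAt φ y M w B
    sumAt-* k w B = trans (ℤΣ.sum-cong-≗ (λ t → when-* _ k (w (B [ t ]≔ y)))) (sym (ℤΣ.*-distribˡ-sum k (summand w B)))

    sumAt-when : ∀ b (w : Vec Bool n → ℤ) B → sumAt φ y M (λ A → when b (w A)) B ≡ when b (sumAt φ y M w B)
    sumAt-when true  w B = refl
    sumAt-when false w B = trans (ℤΣ.sum-cong-≗ (λ t → when-0ℤ (φ (lookup M t) (lookup B t)))) (ℤΣ.sum-replicate-zero n)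

  κ : ∀ {n} → Vec Bool n → Vec Bool n → ℤ
  κ []          []          = 0ℤ
  κ (true ∷ M)  (true ∷ A)  = 1ℤ + κ M A
  κ (true ∷ M)  (false ∷ A) = - 1ℤ + κ M A
  κ (false ∷ M) (_ ∷ A)     = κ M A

  Σ↓Σ↑-commutator : ∀ {n} (M : Vec Bool n) (w : Vec Bool n → ℤ) A →
                    Σ↓ M (Σ↑ M w) A - Σ↑ M (Σ↓ M w) A ≡ κ M A * w A
  Σ↓Σ↑-commutator [] w [] = refl
  Σ↓Σ↑-commutator {suc n} (true ∷ M) w (true ∷ A) = begin
    (w₁ A + Σ↑ M w₀ A) + Σ↓ M (λ A′ → 0ℤ + Σ↑ M w₁ A′) A - (0ℤ + Σ↑ M (λ A′ → w₀ A′ + Σ↓ M w₁ A′) A)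
      ≡⟨ cong₂ (λ d u → (w₁ A + Σ↑ M w₀ A) + d - (0ℤ + u)) (sumAt-0+ φ↓ false M (Σ↑ M w₁) A) (sumAt-+ φ↑ true M w₀ (Σ↓ M w₁) A) ⟩
    (w₁ A + Σ↑ M w₀ A) + Σ↓ M (Σ↑ M w₁) A - (0ℤ + (Σ↑ M w₀ A + Σ↑ M (Σ↓ M w₁) A))
      ≡⟨ rearrange (w₁ A) (Σ↑ M w₀ A) (Σ↓ M (Σ↑ M w₁) A) (Σ↑ M (Σ↓ M w₁) A) ⟩
    w₁ A + (Σ↓ M (Σ↑ M w₁) A - Σ↑ M (Σ↓ M w₁) A)
      ≡⟨ cong (λ z → w₁ A + z) (Σ↓Σ↑-commutator M w₁ A) ⟩
    w₁ A + κ M A * w₁ A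
      ≡⟨ collect (w₁ A) (κ M A) ⟩
    (1ℤ + κ M A) * w₁ A ∎
    where
    open ≡-Reasoning
    w₀ w₁ : Vec Bool n → ℤ
    w₀ A = w (false ∷ A)
    w₁ A = w (true ∷ A)
    rearrange : ∀ a b p q → (a + b) + p - (0ℤ + (b + q)) ≡ a + (p - q)
    rearrange = solve-∀
    collect : ∀ a k → a + k * a ≡ (1ℤ + k) * a
    collect = solve-∀
  Σ↓Σ↑-commutator {suc n} (true ∷ M) w (false ∷ A) = begin
    0ℤ + Σ↓ M (λ A′ → w₁ A′ + Σ↑ M w₀ A′) A - ((w₀ A + Σ↓ M w₁ A) + Σ↑ M (λ A′ → 0ℤ + Σ↓ M w₀ A′) A)
      ≡⟨ cong₂ (λ d u → 0ℤ + d - ((w₀ A + Σ↓ M w₁ A) + u)) (sumAt-+ φ↓ false M w₁ (Σ↑ M w₀) A) (sumAt-0+ φ↑ true M (Σ↓ M w₀) A) ⟩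
    0ℤ + (Σ↓ M w₁ A + Σ↓ M (Σ↑ M w₀) A) - ((w₀ A + Σ↓ M w₁ A) + Σ↑ M (Σ↓ M w₀) A)
      ≡⟨ rearrange (w₀ A) (Σ↓ M w₁ A) (Σ↓ M (Σ↑ M w₀) A) (Σ↑ M (Σ↓ M w₀) A) ⟩
    - w₀ A + (Σ↓ M (Σ↑ M w₀) A - Σ↑ M (Σ↓ M w₀) A)
      ≡⟨ cong (λ z → - w₀ A + z) (Σ↓Σ↑-commutator M w₀ A) ⟩
    - w₀ A + κ M A * w₀ A
      ≡⟨ collect (w₀ A) (κ M A) ⟩
    (- 1ℤ + κ M A) * w₀ A ∎
    where
    open ≡-Reasoning
    w₀ w₁ : Vec Bool n → ℤ
    w₀ A = w (false ∷ A)
    w₁ A = w (true ∷ A)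
    rearrange : ∀ a b p q → 0ℤ + (b + p) - ((a + b) + q) ≡ - a + (p - q)
    rearrange = solve-∀
    collect : ∀ a k → - a + k * a ≡ (- 1ℤ + k) * a
    collect = solve-∀
  Σ↓Σ↑-commutator {suc n} (false ∷ M) w (x ∷ A) = begin
    0ℤ + Σ↓ M (λ A′ → 0ℤ + Σ↑ M wₓ A′) A - (0ℤ + Σ↑ M (λ A′ → 0ℤ + Σ↓ M wₓ A′) A)
      ≡⟨ cong₂ (λ d u → 0ℤ + d - (0ℤ + u)) (sumAt-0+ φ↓ false M (Σ↑ M wₓ) A) (sumAt-0+ φ↑ true M (Σ↓ M wₓ) A) ⟩
    0ℤ + Σ↓ M (Σ↑ M wₓ) A - (0ℤ + Σ↑ M (Σ↓ M wₓ) A)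
      ≡⟨ drop0 (Σ↓ M (Σ↑ M wₓ) A) (Σ↑ M (Σ↓ M wₓ) A) ⟩
    Σ↓ M (Σ↑ M wₓ) A - Σ↑ M (Σ↓ M wₓ) A
      ≡⟨ Σ↓Σ↑-commutator M wₓ A ⟩
    κ M A * wₓ A ∎
    where
    open ≡-Reasoning
    wₓ : Vec Bool n → ℤ
    wₓ A = w (x ∷ A)
    drop0 : ∀ p q → 0ℤ + p - (0ℤ + q) ≡ p - q
    drop0 = solve-∀

  ΣV : ∀ {n} → (Vec Bool n → ℤ) → ℤ
  ΣV {zero}  F = F []
  ΣV {suc n} F = ΣV (λ A → F (false ∷ A)) + ΣV (λ A → F (true ∷ A))

  ΣV-cong : ∀ {n} {F G : Vec Bool n → ℤ} → (∀ A → F A ≡ G A) → ΣV F ≡ ΣV G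
  ΣV-cong {zero}  F≗G = F≗G []
  ΣV-cong {suc n} F≗G = cong₂ _+_ (ΣV-cong (λ A → F≗G (false ∷ A))) (ΣV-cong (λ A → F≗G (true ∷ A)))

  ΣV-+ : ∀ {n} (F G : Vec Bool n → ℤ) → ΣV (λ A → F A + G A) ≡ ΣV F + ΣV G
  ΣV-+ {zero}  F G = refl
  ΣV-+ {suc n} F G = trans (cong₂ _+_ (ΣV-+ (λ A → F (false ∷ A)) (λ A → G (false ∷ A))) (ΣV-+ (λ A → F (true ∷ A)) (λ A → G (true ∷ A))))
                           (interchange (ΣV (λ A → F (false ∷ A))) (ΣV (λ A → G (false ∷ A))) (ΣV (λ A → F (true ∷ A))) (ΣV (λ A → G (true ∷ A))))
    where
    interchange : ∀ a b c d → (a + b) + (c + d) ≡ (a + c) + (b + d)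
    interchange = solve-∀

  ΣV-neg : ∀ {n} (F : Vec Bool n → ℤ) → ΣV (λ A → - F A) ≡ - ΣV F
  ΣV-neg {zero}  F = refl
  ΣV-neg {suc n} F = trans (cong₂ _+_ (ΣV-neg (λ A → F (false ∷ A))) (ΣV-neg (λ A → F (true ∷ A))))
                           (sym (ℤP.neg-distrib-+ (ΣV (λ A → F (false ∷ A))) (ΣV (λ A → F (true ∷ A)))))

  ΣV-* : ∀ {n} k (F : Vec Bool n → ℤ) → ΣV (λ A → k * F A) ≡ k * ΣV F
  ΣV-* {zero}  k F = refl
  ΣV-* {suc n} k F = trans (cong₂ _+_ (ΣV-* k (λ A → F (false ∷ A))) (ΣV-* k (λ A → F (true ∷ A))))
                           (sym (ℤP.*-distribˡ-+ k _ _))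

  Σ↑-Σ↓-adjoint : ∀ {n} (M : Vec Bool n) (w u : Vec Bool n → ℤ) → ΣV (λ A → Σ↑ M w A * u A) ≡ ΣV (λ A → w A * Σ↓ M u A)
  Σ↑-Σ↓-adjoint [] w u = trans (ℤP.*-zeroˡ (u [])) (sym (ℤP.*-zeroʳ (w [])))
  Σ↑-Σ↓-adjoint {suc n} (true ∷ M) w u = begin
      ΣV (λ A → (w₁ A + Σ↑ M w₀ A) * u₀ A) + ΣV (λ A → (0ℤ + Σ↑ M w₁ A) * u₁ A)
    ≡⟨ cong₂ _+_ (ΣV-cong (λ A → ℤP.*-distribʳ-+ (u₀ A) (w₁ A) (Σ↑ M w₀ A)))
                 (ΣV-cong (λ A → cong (_* u₁ A) (ℤP.+-identityˡ (Σ↑ M w₁ A)))) ⟩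
      ΣV (λ A → w₁ A * u₀ A + Σ↑ M w₀ A * u₀ A) + ΣV (λ A → Σ↑ M w₁ A * u₁ A)
    ≡⟨ cong (_+ ΣV (λ A → Σ↑ M w₁ A * u₁ A)) (ΣV-+ (λ A → w₁ A * u₀ A) (λ A → Σ↑ M w₀ A * u₀ A)) ⟩
      ΣV (λ A → w₁ A * u₀ A) + ΣV (λ A → Σ↑ M w₀ A * u₀ A) + ΣV (λ A → Σ↑ M w₁ A * u₁ A)
    ≡⟨ cong₂ (λ p q → ΣV (λ A → w₁ A * u₀ A) + p + q) (Σ↑-Σ↓-adjoint M w₀ u₀) (Σ↑-Σ↓-adjoint M w₁ u₁) ⟩
      ΣV (λ A → w₁ A * u₀ A) + ΣV (λ A → w₀ A * Σ↓ M u₀ A) + ΣV (λ A → w₁ A * Σ↓ M u₁ A)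
    ≡⟨ rotate (ΣV (λ A → w₁ A * u₀ A)) (ΣV (λ A → w₀ A * Σ↓ M u₀ A)) (ΣV (λ A → w₁ A * Σ↓ M u₁ A)) ⟩
      ΣV (λ A → w₀ A * Σ↓ M u₀ A) + (ΣV (λ A → w₁ A * u₀ A) + ΣV (λ A → w₁ A * Σ↓ M u₁ A))
    ≡⟨ cong₂ _+_ (ΣV-cong (λ A → cong (w₀ A *_) (sym (ℤP.+-identityˡ (Σ↓ M u₀ A)))))
                 (sym (ΣV-+ (λ A → w₁ A * u₀ A) (λ A → w₁ A * Σ↓ M u₁ A))) ⟩
      ΣV (λ A → w₀ A * (0ℤ + Σ↓ M u₀ A)) + ΣV (λ A → w₁ A * u₀ A + w₁ A * Σ↓ M u₁ A)
    ≡⟨ cong (λ z → ΣV (λ A → w₀ A * (0ℤ + Σ↓ M u₀ A)) + z) (ΣV-cong (λ A → sym (ℤP.*-distribˡ-+ (w₁ A) (u₀ A) (Σ↓ M u₁ A)))) ⟩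
      ΣV (λ A → w₀ A * (0ℤ + Σ↓ M u₀ A)) + ΣV (λ A → w₁ A * (u₀ A + Σ↓ M u₁ A))
    ∎
    where
    open ≡-Reasoning
    w₀ w₁ u₀ u₁ : Vec Bool n → ℤ
    w₀ A = w (false ∷ A)
    w₁ A = w (true ∷ A)
    u₀ A = u (false ∷ A)
    u₁ A = u (true ∷ A)
    rotate : ∀ x y z → x + y + z ≡ y + (x + z)
    rotate = solve-∀
  Σ↑-Σ↓-adjoint {suc n} (false ∷ M) w u = begin
      ΣV (λ A → (0ℤ + Σ↑ M w₀ A) * u₀ A) + ΣV (λ A → (0ℤ + Σ↑ M w₁ A) * u₁ A)
    ≡⟨ cong₂ _+_ (ΣV-cong (λ A → cong (_* u₀ A) (ℤP.+-identityˡ (Σ↑ M w₀ A))))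
                 (ΣV-cong (λ A → cong (_* u₁ A) (ℤP.+-identityˡ (Σ↑ M w₁ A)))) ⟩
      ΣV (λ A → Σ↑ M w₀ A * u₀ A) + ΣV (λ A → Σ↑ M w₁ A * u₁ A)
    ≡⟨ cong₂ _+_ (Σ↑-Σ↓-adjoint M w₀ u₀) (Σ↑-Σ↓-adjoint M w₁ u₁) ⟩
      ΣV (λ A → w₀ A * Σ↓ M u₀ A) + ΣV (λ A → w₁ A * Σ↓ M u₁ A)
    ≡⟨ cong₂ _+_ (ΣV-cong (λ A → cong (w₀ A *_) (sym (ℤP.+-identityˡ (Σ↓ M u₀ A)))))
                 (ΣV-cong (λ A → cong (w₁ A *_) (sym (ℤP.+-identityˡ (Σ↓ M u₁ A))))) ⟩
      ΣV (λ A → w₀ A * (0ℤ + Σ↓ M u₀ A)) + ΣV (λ A → w₁ A * (0ℤ + Σ↓ M u₁ A))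
    ∎
    where
    open ≡-Reasoning
    w₀ w₁ u₀ u₁ : Vec Bool n → ℤ
    w₀ A = w (false ∷ A)
    w₁ A = w (true ∷ A)
    u₀ A = u (false ∷ A)
    u₁ A = u (true ∷ A)

  ΣVℕ : ∀ {n} → (Vec Bool n → ℕ) → ℕ
  ΣVℕ {zero}  F = F []
  ΣVℕ {suc n} F = ΣVℕ (λ A → F (false ∷ A)) ℕ.+ ΣVℕ (λ A → F (true ∷ A))

  ΣVℕ≡0⇒≡0 : ∀ {n} (F : Vec Bool n → ℕ) → ΣVℕ F ≡ 0 → ∀ A → F A ≡ 0
  ΣVℕ≡0⇒≡0 {zero}  F ΣF≡0 [] = ΣF≡0
  ΣVℕ≡0⇒≡0 {suc n} F ΣF≡0 (false ∷ A) = ΣVℕ≡0⇒≡0 (λ A → F (false ∷ A)) (ℕP.m+n≡0⇒m≡0 _ ΣF≡0) A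
  ΣVℕ≡0⇒≡0 {suc n} F ΣF≡0 (true ∷ A)  = ΣVℕ≡0⇒≡0 (λ A → F (true ∷ A)) (ℕP.m+n≡0⇒n≡0 (ΣVℕ (λ A → F (false ∷ A))) ΣF≡0) A

  ∣_∣² : ℤ → ℕ
  ∣ i ∣² = ∣ i ∣ ℕ.* ∣ i ∣

  ΣV-squares : ∀ {n} (F : Vec Bool n → ℤ) → ΣV (λ A → F A * F A) ≡ + ΣVℕ (λ A → ∣ F A ∣²)
  ΣV-squares {zero}  F = square (F [])
    where
    square : ∀ i → i * i ≡ + ∣ i ∣²
    square (+ n)    = ℤP.+◃n≡+n (n ℕ.* n)
    square -[1+ n ] = ℤP.+◃n≡+n (suc n ℕ.* suc n)
  ΣV-squares {suc n} F = trans (cong₂ _+_ (ΣV-squares (λ A → F (false ∷ A))) (ΣV-squares (λ A → F (true ∷ A))))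
                               (sym (ℤP.pos-+ (ΣVℕ (λ A → ∣ F (false ∷ A) ∣²)) _))

  ∣∣²≡0⇒≡0ℤ : ∀ i → ∣ i ∣² ≡ 0 → i ≡ 0ℤ
  ∣∣²≡0⇒≡0ℤ (+ zero) _ = refl

  -- If κ acts on the support of w as a positive scalar, then
  -- ⟨w, Σ↓Σ↑ w⟩ = ‖Σ↓ w‖² + (1 + c) ‖w‖², so Σ↑ w = 0 forces w = 0.
  Σ↑≡0⇒≡0 : ∀ {n} (M : Vec Bool n) (w : Vec Bool n → ℤ) (c : ℕ) → (∀ B → Σ↑ M w B ≡ 0ℤ) →
            (∀ A → κ M A * w A ≡ + suc c * w A) → ∀ A → w A ≡ 0ℤ
  Σ↑≡0⇒≡0 M w c Σ↑w≡0 κw≡ A = ∣∣²≡0⇒≡0ℤ (w A) (ΣVℕ≡0⇒≡0 _ ‖w‖²≡0 A)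
    where
    open ≡-Reasoning
    ‖w‖² ‖Σ↓w‖² : ℕ
    ‖w‖² = ΣVℕ (λ A → ∣ w A ∣²)
    ‖Σ↓w‖² = ΣVℕ (λ A → ∣ Σ↓ M w A ∣²)
    ⟨w,Σ↓Σ↑w⟩ ⟨w,Σ↑Σ↓w⟩ : ℤ
    ⟨w,Σ↓Σ↑w⟩ = ΣV (λ A → w A * Σ↓ M (Σ↑ M w) A)
    ⟨w,Σ↑Σ↓w⟩ = ΣV (λ A → w A * Σ↑ M (Σ↓ M w) A)
    ⟨w,Σ↓Σ↑w⟩≡0 : ⟨w,Σ↓Σ↑w⟩ ≡ 0ℤ
    ⟨w,Σ↓Σ↑w⟩≡0 = begin
      ⟨w,Σ↓Σ↑w⟩                          ≡⟨ Σ↑-Σ↓-adjoint M w (Σ↑ M w) ⟨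
      ΣV (λ A → Σ↑ M w A * Σ↑ M w A)     ≡⟨ ΣV-cong (λ A → cong (_* Σ↑ M w A) (Σ↑w≡0 A)) ⟩
      ΣV (λ A → 0ℤ * Σ↑ M w A)           ≡⟨ ΣV-* 0ℤ (Σ↑ M w) ⟩
      0ℤ * ΣV (Σ↑ M w)                   ≡⟨ ℤP.*-zeroˡ (ΣV (Σ↑ M w)) ⟩
      0ℤ                                 ∎
    ⟨w,Σ↑Σ↓w⟩≡‖Σ↓w‖² : ⟨w,Σ↑Σ↓w⟩ ≡ + ‖Σ↓w‖²
    ⟨w,Σ↑Σ↓w⟩≡‖Σ↓w‖² = begin
      ⟨w,Σ↑Σ↓w⟩                          ≡⟨ ΣV-cong (λ A → ℤP.*-comm (w A) _) ⟩
      ΣV (λ A → Σ↑ M (Σ↓ M w) A * w A)   ≡⟨ Σ↑-Σ↓-adjoint M (Σ↓ M w) w ⟩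
      ΣV (λ A → Σ↓ M w A * Σ↓ M w A)     ≡⟨ ΣV-squares (Σ↓ M w) ⟩
      + ‖Σ↓w‖²                           ∎
    commutator : ⟨w,Σ↓Σ↑w⟩ - ⟨w,Σ↑Σ↓w⟩ ≡ + suc c * + ‖w‖²
    commutator = begin
      ⟨w,Σ↓Σ↑w⟩ - ⟨w,Σ↑Σ↓w⟩
        ≡⟨ cong (λ z → ⟨w,Σ↓Σ↑w⟩ + z) (ΣV-neg (λ A → w A * Σ↑ M (Σ↓ M w) A)) ⟨
      ⟨w,Σ↓Σ↑w⟩ + ΣV (λ A → - (w A * Σ↑ M (Σ↓ M w) A))
        ≡⟨ ΣV-+ (λ A → w A * Σ↓ M (Σ↑ M w) A) (λ A → - (w A * Σ↑ M (Σ↓ M w) A)) ⟨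
      ΣV (λ A → w A * Σ↓ M (Σ↑ M w) A + - (w A * Σ↑ M (Σ↓ M w) A))
        ≡⟨ ΣV-cong (λ A → trans (factor (w A) _ _) (cong (w A *_) (trans (Σ↓Σ↑-commutator M w A) (κw≡ A)))) ⟩
      ΣV (λ A → w A * (+ suc c * w A))
        ≡⟨ ΣV-cong (λ A → swap (w A) (+ suc c)) ⟩
      ΣV (λ A → + suc c * (w A * w A))
        ≡⟨ ΣV-* (+ suc c) (λ A → w A * w A) ⟩
      + suc c * ΣV (λ A → w A * w A)
        ≡⟨ cong (+ suc c *_) (ΣV-squares w) ⟩
      + suc c * + ‖w‖² ∎
      where
      factor : ∀ a p q → a * p + - (a * q) ≡ a * (p - q)
      factor = solve-∀
      swap : ∀ a k → a * (k * a) ≡ k * (a * a)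
      swap = solve-∀
    weighted-sum≡0 : + (suc c ℕ.* ‖w‖² ℕ.+ ‖Σ↓w‖²) ≡ 0ℤ
    weighted-sum≡0 = begin
      + (suc c ℕ.* ‖w‖² ℕ.+ ‖Σ↓w‖²)          ≡⟨ ℤP.pos-+ (suc c ℕ.* ‖w‖²) ‖Σ↓w‖² ⟩
      + (suc c ℕ.* ‖w‖²) + + ‖Σ↓w‖²          ≡⟨ cong (_+ + ‖Σ↓w‖²) (ℤP.pos-* (suc c) ‖w‖²) ⟩
      + suc c * + ‖w‖² + + ‖Σ↓w‖²            ≡⟨ cong₂ _+_ commutator ⟨w,Σ↑Σ↓w⟩≡‖Σ↓w‖² ⟨
      ⟨w,Σ↓Σ↑w⟩ - ⟨w,Σ↑Σ↓w⟩ + ⟨w,Σ↑Σ↓w⟩     ≡⟨ cancel ⟨w,Σ↓Σ↑w⟩ ⟨w,Σ↑Σ↓w⟩ ⟩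
      ⟨w,Σ↓Σ↑w⟩                              ≡⟨ ⟨w,Σ↓Σ↑w⟩≡0 ⟩
      0ℤ                                     ∎
      where
      cancel : ∀ a b → a - b + b ≡ a
      cancel = solve-∀
    ‖w‖²≡0 : ‖w‖² ≡ 0
    ‖w‖²≡0 = ℕP.m*n≡0⇒m≡0 ‖w‖² (suc c)
               (trans (ℕP.*-comm ‖w‖² (suc c)) (ℕP.m+n≡0⇒m≡0 _ (ℤP.+-injective weighted-sum≡0)))

  card : ∀ {n} → Vec Bool n → ℕ
  card {n} B = ∑[ t < n ] (if lookup B t then 1 else 0)

  _⊆ᵇ_ : ∀ {n} → Vec Bool n → Vec Bool n → Bool
  []      ⊆ᵇ []      = true
  (x ∷ A) ⊆ᵇ (m ∷ M) = (not x ∨ m) ∧ (A ⊆ᵇ M)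

  ⊆ᵇ-sound : ∀ {n} (A M : Vec Bool n) → A ⊆ᵇ M ≡ true → ∀ t → lookup A t ≡ true → lookup M t ≡ true
  ⊆ᵇ-sound (true ∷ A)  (true ∷ M)  _   zero    _ = refl
  ⊆ᵇ-sound (true ∷ A)  (false ∷ M) ()  zero    _
  ⊆ᵇ-sound (x ∷ A)     (m ∷ M)     A⊆M (suc t)   = ⊆ᵇ-sound A M (∧-true-right (not x ∨ m) A⊆M) t
    where
    ∧-true-right : ∀ a {b} → a ∧ b ≡ true → b ≡ true
    ∧-true-right true b≡true = b≡true

  ⊆ᵇ-complete : ∀ {n} (A M : Vec Bool n) → (∀ t → lookup A t ≡ true → lookup M t ≡ true) → A ⊆ᵇ M ≡ true
  ⊆ᵇ-complete []          []      _   = refl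
  ⊆ᵇ-complete (false ∷ A) (m ∷ M) A⊆M = ⊆ᵇ-complete A M (λ t → A⊆M (suc t))
  ⊆ᵇ-complete (true ∷ A)  (m ∷ M) A⊆M rewrite A⊆M zero refl = ⊆ᵇ-complete A M (λ t → A⊆M (suc t))

  Σ↑ℕ : ∀ {n} → Vec Bool n → (Vec Bool n → ℕ) → Vec Bool n → ℕ
  Σ↑ℕ {n} M v B = ∑[ t < n ] (if lookup M t ∧ not (lookup B t) then v (B [ t ]≔ true) else 0)

  Σ↑-ℕ : ∀ {n} (M : Vec Bool n) (v : Vec Bool n → ℕ) B → Σ↑ M (λ A → + v A) B ≡ + Σ↑ℕ M v B
  Σ↑-ℕ []      v []      = refl
  Σ↑-ℕ (m ∷ M) v (x ∷ B) = trans (cong₂ _+_ (when-+ℕ (m ∧ not x)) (Σ↑-ℕ M (λ A → v (x ∷ A)) B))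
                                (sym (ℤP.pos-+ _ (Σ↑ℕ M (λ A → v (x ∷ A)) B)))
    where
    when-+ℕ : ∀ b → when b (+ v (true ∷ B)) ≡ + (if b then v (true ∷ B) else 0)
    when-+ℕ true  = refl
    when-+ℕ false = refl

  Σ↑-const : ∀ {n} (M : Vec Bool n) k B → Σ↑ M (λ _ → k) B ≡ k * + Σ↑ℕ M (λ _ → 1) B
  Σ↑-const M k B = begin
    Σ↑ M (λ _ → k) B          ≡⟨ sumAt-cong φ↑ true M (λ _ → sym (ℤP.*-identityʳ k)) B ⟩
    Σ↑ M (λ _ → k * + 1) B    ≡⟨ sumAt-* φ↑ true M k (λ _ → + 1) B ⟩
    k * Σ↑ M (λ _ → + 1) B    ≡⟨ cong (k *_) (Σ↑-ℕ M (λ _ → 1) B) ⟩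
    k * + Σ↑ℕ M (λ _ → 1) B   ∎
    where open ≡-Reasoning

  Σ↑ℕ-1+card : ∀ {n} (M B : Vec Bool n) → B ⊆ᵇ M ≡ true → Σ↑ℕ M (λ _ → 1) B ℕ.+ card B ≡ card M
  Σ↑ℕ-1+card []          []          _    = refl
  Σ↑ℕ-1+card (true ∷ M)  (true ∷ B)  B⊆M = trans (ℕP.+-suc _ _) (cong suc (Σ↑ℕ-1+card M B B⊆M))
  Σ↑ℕ-1+card (true ∷ M)  (false ∷ B) B⊆M = cong suc (Σ↑ℕ-1+card M B B⊆M)
  Σ↑ℕ-1+card (false ∷ M) (false ∷ B) B⊆M = Σ↑ℕ-1+card M B B⊆M

  ⊆ᵇ-insert : ∀ {n} (M B : Vec Bool n) t → φ↑ (lookup M t) (lookup B t) ≡ true → (B [ t ]≔ true) ⊆ᵇ M ≡ B ⊆ᵇ M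
  ⊆ᵇ-insert (true ∷ M) (false ∷ B) zero    _ = refl
  ⊆ᵇ-insert (m ∷ M)    (x ∷ B)     (suc t) t∈M∖B = cong ((not x ∨ m) ∧_) (⊆ᵇ-insert M B t t∈M∖B)

  card-insert : ∀ {n} (M B : Vec Bool n) t → φ↑ (lookup M t) (lookup B t) ≡ true → card (B [ t ]≔ true) ≡ suc (card B)
  card-insert (true ∷ M) (false ∷ B) zero    _ = refl
  card-insert (m ∷ M)    (true ∷ B)  (suc t) t∈M∖B = cong suc (card-insert M B t t∈M∖B)
  card-insert (m ∷ M)    (false ∷ B) (suc t) t∈M∖B = card-insert M B t t∈M∖B

  κ-card : ∀ {n} (M A : Vec Bool n) → A ⊆ᵇ M ≡ true → κ M A + + card M ≡ + card A + + card A
  κ-card []          []          _   = refl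
  κ-card (true ∷ M)  (true ∷ A)  A⊆M = trans (shift (κ M A) (+ card M)) (trans (cong (λ z → 1ℤ + z + 1ℤ) (κ-card M A A⊆M)) (regroup (+ card A)))
    where
    shift : ∀ a b → 1ℤ + a + (1ℤ + b) ≡ 1ℤ + (a + b) + 1ℤ
    shift = solve-∀
    regroup : ∀ a → 1ℤ + (a + a) + 1ℤ ≡ (1ℤ + a) + (1ℤ + a)
    regroup = solve-∀
  κ-card (true ∷ M)  (false ∷ A) A⊆M = trans (cancel (κ M A) (+ card M)) (κ-card M A A⊆M)
    where
    cancel : ∀ a b → - 1ℤ + a + (1ℤ + b) ≡ a + b
    cancel = solve-∀
  κ-card (false ∷ M) (false ∷ A) A⊆M = κ-card M A A⊆M

  onLevel : ∀ {n} → ℕ → Vec Bool n → Vec Bool n → Bool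
  onLevel k M A = A ⊆ᵇ M ∧ (card A ℕ.≡ᵇ k)

  onLevel-sound : ∀ {n} k (M A : Vec Bool n) → onLevel k M A ≡ true → A ⊆ᵇ M ≡ true × card A ≡ k
  onLevel-sound k M A A∈k with A ⊆ᵇ M | card A ℕ.≡ᵇ k in |A|≡ᵇk
  onLevel-sound k M A refl | true | true = refl , ℕP.≡ᵇ⇒≡ (card A) k (subst T (sym |A|≡ᵇk) _)

  onLevel-complete : ∀ {n} k (M A : Vec Bool n) → A ⊆ᵇ M ≡ true → card A ≡ k → onLevel k M A ≡ true
  onLevel-complete k M A A⊆M |A|≡k = cong₂ _∧_ A⊆M (dec-true (card A ℕ.≟ k) |A|≡k)

  Σ↑-restrict : ∀ {n} k (M : Vec Bool n) (X : Vec Bool n → ℤ) B →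
                Σ↑ M (λ A → when (onLevel (suc k) M A) (X A)) B ≡ when (onLevel k M B) (Σ↑ M X B)
  Σ↑-restrict k M X B = trans (ℤΣ.sum-cong-≗ guarded) (sumAt-when φ↑ true M (onLevel k M B) X B)
    where
    guarded : ∀ t → when (φ↑ (lookup M t) (lookup B t)) (when (onLevel (suc k) M (B [ t ]≔ true)) (X (B [ t ]≔ true)))
                  ≡ when (φ↑ (lookup M t) (lookup B t)) (when (onLevel k M B) (X (B [ t ]≔ true)))
    guarded t with φ↑ (lookup M t) (lookup B t) in t∈M∖B
    ... | false = refl
    ... | true rewrite ⊆ᵇ-insert M B t t∈M∖B | card-insert M B t t∈M∖B = refl

  κ-upper : ∀ {n} b (M A : Vec Bool n) → card M ≤ suc (b ℕ.+ b) → onLevel (suc b) M A ≡ true →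
            κ M A ≡ + suc (suc (b ℕ.+ b) ∸ card M)
  κ-upper b M A |M|≤2b+1 A∈b+1 = begin
    κ M A                            ≡⟨ add-sub (κ M A) (+ card M) ⟩
    κ M A + + card M - + card M      ≡⟨ cong (_- + card M) (κ-card M A (proj₁ A-sub)) ⟩
    + card A + + card A - + card M   ≡⟨ cong (λ z → + z + + z - + card M) (proj₂ A-sub) ⟩
    + suc b + + suc b - + card M     ≡⟨ cong (_- + card M) (ℤP.pos-+ (suc b) (suc b)) ⟨
    + (suc b ℕ.+ suc b) - + card M   ≡⟨ cong (λ z → + z - + card M) c+k≡ ⟨
    + (suc c ℕ.+ card M) - + card M  ≡⟨ cong (_- + card M) (ℤP.pos-+ (suc c) (card M)) ⟩
    + suc c + + card M - + card M    ≡⟨ add-sub (+ suc c) (+ card M) ⟨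
    + suc c                          ∎
    where
    open ≡-Reasoning
    c : ℕ
    c = suc (b ℕ.+ b) ∸ card M
    A-sub : A ⊆ᵇ M ≡ true × card A ≡ suc b
    A-sub = onLevel-sound (suc b) M A A∈b+1
    c+k≡ : suc c ℕ.+ card M ≡ suc b ℕ.+ suc b
    c+k≡ = trans (cong suc (ℕP.m∸n+n≡m |M|≤2b+1)) (sym (cong suc (ℕP.+-suc b b)))
    add-sub : ∀ x y → x ≡ x + y - y
    add-sub = solve-∀

  -- card M ∸ b is the number of (b+1)-subsets of M containing a given b-subset.
  Σ↑ℕ-constant⇒constant : ∀ {n} (M : Vec Bool n) (b C : ℕ) (v : Vec Bool n → ℕ) → card M ≤ suc (b ℕ.+ b) →
                          (∀ B → B ⊆ᵇ M ≡ true → card B ≡ b → Σ↑ℕ M v B ≡ C) →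
                          ∀ A → A ⊆ᵇ M ≡ true → card A ≡ suc b → (card M ∸ b) ℕ.* v A ≡ C
  Σ↑ℕ-constant⇒constant {n} M b C v |M|≤2b+1 Σ↑v≡C A A⊆M |A|≡b+1 =
    ℤP.+-injective (trans (ℤP.pos-* d (v A)) (ℤP.i-j≡0⇒i≡j _ _ XA≡0))
    where
    open ≡-Reasoning
    d : ℕ
    d = card M ∸ b
    X w : Vec Bool n → ℤ
    X A = + d * + v A - + C
    w A = when (onLevel (suc b) M A) (X A)

    Σ↑X≡0 : ∀ B → B ⊆ᵇ M ≡ true × card B ≡ b → Σ↑ M X B ≡ 0ℤ
    Σ↑X≡0 B (B⊆M , |B|≡b) = begin
      Σ↑ M X B
        ≡⟨ sumAt-+ φ↑ true M (λ A → + d * + v A) (λ _ → - + C) B ⟩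
      Σ↑ M (λ A → + d * + v A) B + Σ↑ M (λ _ → - + C) B
        ≡⟨ cong₂ _+_ (sumAt-* φ↑ true M (+ d) (λ A → + v A) B) (Σ↑-const M (- + C) B) ⟩
      + d * Σ↑ M (λ A → + v A) B + - + C * + Σ↑ℕ M (λ _ → 1) B
        ≡⟨ cong₂ (λ p q → + d * p + - + C * + q) (trans (Σ↑-ℕ M v B) (cong +_ (Σ↑v≡C B B⊆M |B|≡b))) free≡d ⟩
      + d * + C + - + C * + d
        ≡⟨ cancel (+ d) (+ C) ⟩
      0ℤ ∎
      where
      cancel : ∀ x y → x * y + - y * x ≡ 0ℤ
      cancel = solve-∀
      free≡d : Σ↑ℕ M (λ _ → 1) B ≡ d
      free≡d = trans (sym (ℕP.m+n∸n≡m _ (card B))) (cong₂ _∸_ (Σ↑ℕ-1+card M B B⊆M) |B|≡b)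

    Σ↑w≡0 : ∀ B → Σ↑ M w B ≡ 0ℤ
    Σ↑w≡0 B = trans (Σ↑-restrict b M X B) (on-level-b (onLevel b M B) refl)
      where
      on-level-b : ∀ x → onLevel b M B ≡ x → when x (Σ↑ M X B) ≡ 0ℤ
      on-level-b true  B∈b = Σ↑X≡0 B (onLevel-sound b M B B∈b)
      on-level-b false _   = refl

    κw≡ : ∀ A → κ M A * w A ≡ + suc (suc (b ℕ.+ b) ∸ card M) * w A
    κw≡ A with onLevel (suc b) M A in A∈b+1
    ... | true  = cong (_* X A) (κ-upper b M A |M|≤2b+1 A∈b+1)
    ... | false = trans (ℤP.*-zeroʳ (κ M A)) (sym (ℤP.*-zeroʳ (+ suc (suc (b ℕ.+ b) ∸ card M))))

    XA≡0 : X A ≡ 0ℤ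
    XA≡0 = begin
      X A  ≡⟨ cong (λ x → when x (X A)) (onLevel-complete (suc b) M A A⊆M |A|≡b+1) ⟨
      w A  ≡⟨ Σ↑≡0⇒≡0 M w (suc (b ℕ.+ b) ∸ card M) Σ↑w≡0 κw≡ A ⟩
      0ℤ   ∎

module Dominance where

  open import Data.Nat as ℕ using (ℕ; zero; suc; _+_; _<_; _≤_; _∸_; z≤n; s≤s; pred)
  import Data.Nat.Properties as ℕP
  open import Data.Product using (∃; _×_; _,_)
  open import Data.List using (List; []; _∷_; take; length; lookup)
  open import Data.Fin as Fin using (Fin; toℕ)
  import Data.List.Properties as ListP
  open import Data.List.Relation.Unary.Linked using ([]; _∷_)
  open import Data.Nat.ListAction using (sum)
  open import Defs using (IsPartition; _⊴_; size)
  open import Data.Sum using (_⊎_; inj₁; inj₂)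
  open import Relation.Nullary using (¬_; Dec; yes; no; contradiction)
  open import Relation.Binary.PropositionalEquality

  Seq : Set
  Seq = ℕ → ℕ

  prefix : Seq → ℕ → ℕ
  prefix ν zero    = 0
  prefix ν (suc k) = prefix ν k + ν k

  nth : List ℕ → Seq
  nth []       _       = 0
  nth (x ∷ xs) zero    = x
  nth (x ∷ xs) (suc k) = nth xs k

  nth-lookup : ∀ sh (r : Fin (length sh)) → nth sh (toℕ r) ≡ lookup sh r
  nth-lookup (x ∷ sh) Fin.zero    = refl
  nth-lookup (x ∷ sh) (Fin.suc r) = nth-lookup sh r

  nth-beyond : ∀ sh {r} → length sh ≤ r → nth sh r ≡ 0
  nth-beyond []       _         = refl
  nth-beyond (x ∷ sh) (s≤s len≤r) = nth-beyond sh len≤r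

  nth>0⇒< : ∀ sh {r} → 0 < nth sh r → r < length sh
  nth>0⇒< sh {r} nth>0 with ℕP.<-≤-connex r (length sh)
  ... | inj₁ r<len = r<len
  ... | inj₂ len≤r = contradiction (nth-beyond sh len≤r) (ℕP.>⇒≢ nth>0)

  Decreasing : Seq → Set
  Decreasing ν = ∀ k → ν (suc k) ≤ ν k

  VanishesFrom : ℕ → Seq → Set
  VanishesFrom L ν = ∀ k → L ≤ k → ν k ≡ 0

  _⊴ˢ_ : Seq → Seq → Set
  ν ⊴ˢ μ = ∀ k → prefix ν k ≤ prefix μ k

  Decreasing-mono : ∀ {ν} → Decreasing ν → ∀ {i j} → i ≤ j → ν j ≤ ν i
  Decreasing-mono {ν} ν↓ {i} {j} i≤j with ℕP.m≤n⇒m<n∨m≡n i≤j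
  ... | inj₂ refl = ℕP.≤-refl
  ... | inj₁ i<j  = go j i<j
    where
    go : ∀ j → i < j → ν j ≤ ν i
    go (suc j) (s≤s i≤j) with ℕP.m≤n⇒m<n∨m≡n i≤j
    ... | inj₂ refl = ν↓ i
    ... | inj₁ i<j  = ℕP.≤-trans (ν↓ j) (go j i<j)

  move : Seq → ℕ → ℕ → Seq
  move ν i j k with k ℕP.≟ i | k ℕP.≟ j
  ... | yes _ | _     = suc (ν k)
  ... | no _  | yes _ = pred (ν k)
  ... | no _  | no _  = ν k

  move-at-i : ∀ ν i j → move ν i j i ≡ suc (ν i)
  move-at-i ν i j with i ℕP.≟ i
  ... | yes _  = refl
  ... | no i≢i = contradiction refl i≢i

  move-at-j : ∀ ν {i j} → i ≢ j → move ν i j j ≡ pred (ν j)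
  move-at-j ν {i} {j} i≢j with j ℕP.≟ i | j ℕP.≟ j
  ... | yes j≡i | _      = contradiction (sym j≡i) i≢j
  ... | no _    | yes _  = refl
  ... | no _    | no j≢j = contradiction refl j≢j

  move-elsewhere : ∀ ν {i j k} → k ≢ i → k ≢ j → move ν i j k ≡ ν k
  move-elsewhere ν {i} {j} {k} k≢i k≢j with k ℕP.≟ i | k ℕP.≟ j
  ... | yes k≡i | _       = contradiction k≡i k≢i
  ... | no _    | yes k≡j = contradiction k≡j k≢j
  ... | no _    | no _    = refl

  module _ (ν : Seq) {i j : ℕ} (i<j : i < j) (ν-j>0 : 0 < ν j) where

    private
      ν′ : Seq
      ν′ = move ν i j
      i≢j : i ≢ j
      i≢j = ℕP.<⇒≢ i<j

    prefix-move-≤i : ∀ k → k ≤ i → prefix ν′ k ≡ prefix ν k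
    prefix-move-≤i zero    _   = refl
    prefix-move-≤i (suc k) k<i = cong₂ _+_ (prefix-move-≤i k (ℕP.<⇒≤ k<i))
                                           (move-elsewhere ν (ℕP.<⇒≢ k<i) (ℕP.<⇒≢ (ℕP.<-trans k<i i<j)))

    prefix-move-between : ∀ k → i < k → k ≤ j → prefix ν′ k ≡ suc (prefix ν k)
    prefix-move-between (suc k) (s≤s i≤k) k<j with ℕP.m≤n⇒m<n∨m≡n i≤k
    ... | inj₂ refl = trans (cong₂ _+_ (prefix-move-≤i i ℕP.≤-refl) (move-at-i ν i j)) (ℕP.+-suc _ _)
    ... | inj₁ i<k  = cong₂ _+_ (prefix-move-between k i<k (ℕP.<⇒≤ k<j))
                                (move-elsewhere ν (λ k≡i → ℕP.<⇒≢ i<k (sym k≡i)) (ℕP.<⇒≢ k<j))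

    prefix-move->j : ∀ k → j < k → prefix ν′ k ≡ prefix ν k
    prefix-move->j (suc k) (s≤s j≤k) with ℕP.m≤n⇒m<n∨m≡n j≤k
    ... | inj₂ refl = trans (cong₂ _+_ (prefix-move-between j i<j ℕP.≤-refl) (move-at-j ν i≢j))
                            (trans (sym (ℕP.+-suc (prefix ν j) (pred (ν j)))) (cong (prefix ν j +_) (ℕP.suc-pred (ν j) {{ℕ.>-nonZero ν-j>0}})))
    ... | inj₁ j<k  = cong₂ _+_ (prefix-move->j k j<k)
                                (move-elsewhere ν (λ k≡i → ℕP.<⇒≢ (ℕP.<-trans i<j j<k) (sym k≡i)) (λ k≡j → ℕP.<⇒≢ j<k (sym k≡j)))

    prefix-move-≥ : ∀ k → prefix ν k ≤ prefix ν′ k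
    prefix-move-≥ k with ℕP.≤-<-connex k i
    ... | inj₁ k≤i = ℕP.≤-reflexive (sym (prefix-move-≤i k k≤i))
    ... | inj₂ i<k with ℕP.≤-<-connex k j
    ...   | inj₁ k≤j = ℕP.≤-trans (ℕP.n≤1+n _) (ℕP.≤-reflexive (sym (prefix-move-between k i<k k≤j)))
    ...   | inj₂ j<k = ℕP.≤-reflexive (sym (prefix-move->j k j<k))

  least : (P : ℕ → Set) → (∀ k → Dec (P k)) → ∀ L →
          (∃ λ i → i < L × P i × (∀ k → k < i → ¬ P k)) ⊎ (∀ k → k < L → ¬ P k)
  least P P? zero = inj₂ (λ k ())
  least P P? (suc L) with least P P? L
  ... | inj₁ (i , i<L , Pi , below) = inj₁ (i , ℕP.m≤n⇒m≤1+n i<L , Pi , below)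
  ... | inj₂ none with P? L
  ...   | yes PL = inj₁ (L , ℕP.n<1+n L , PL , none)
  ...   | no ¬PL = inj₂ λ k k<1+L → never k<1+L
    where
    never : ∀ {k} → k < suc L → ¬ P k
    never k<1+L with ℕP.m<1+n⇒m<n∨m≡n k<1+L
    ... | inj₁ k<L  = none _ k<L
    ... | inj₂ refl = ¬PL

  potential : ℕ → Seq → ℕ
  potential zero    f = 0
  potential (suc n) f = potential n f + f n

  potential-mono : ∀ n {f g : Seq} → (∀ k → f k ≤ g k) → potential n f ≤ potential n g
  potential-mono zero    f≤g = z≤n
  potential-mono (suc n) f≤g = ℕP.+-mono-≤ (potential-mono n f≤g) (f≤g n)

  potential-mono-< : ∀ n {f g : Seq} → (∀ k → f k ≤ g k) → ∀ {k₀} → k₀ < n → f k₀ < g k₀ → potential n f < potential n g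
  potential-mono-< (suc n) f≤g k₀<1+n fk₀<gk₀ with ℕP.m<1+n⇒m<n∨m≡n k₀<1+n
  ... | inj₂ refl = ℕP.+-mono-≤-< (potential-mono n f≤g) fk₀<gk₀
  ... | inj₁ k₀<n = ℕP.+-mono-<-≤ (potential-mono-< n f≤g k₀<n fk₀<gk₀) (f≤g n)

  module Chain (μ : Seq) (L : ℕ) (μ↓ : Decreasing μ) (μ-vanish : VanishesFrom L μ) (P : Seq → Set)
               (P-ext : ∀ ν ν′ → (∀ k → ν k ≡ ν′ k) → P ν → P ν′)
               (P-move : ∀ ν {i j} → i < j → 0 < ν j → ν j ≤ ν i → P ν → P (move ν i j)) where

    Invariant : Seq → Set
    Invariant ν = Decreasing ν × VanishesFrom L ν × ν ⊴ˢ μ × prefix ν L ≡ prefix μ L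

    record Choice (ν : Seq) : Set where
      field
        i j         : ℕ
        i<j         : i < j
        j<L         : j < L
        equal-at-i  : prefix ν i ≡ prefix μ i
        behind      : ∀ k → i < k → k ≤ j → prefix ν k < prefix μ k
        equal-after : prefix ν (suc j) ≡ prefix μ (suc j)

    private
      ≤∧¬<⇒≡ : ∀ {a b} → a ≤ b → ¬ a < b → a ≡ b
      ≤∧¬<⇒≡ a≤b ¬a<b with ℕP.m≤n⇒m<n∨m≡n a≤b
      ... | inj₁ a<b = contradiction a<b ¬a<b
      ... | inj₂ a≡b = a≡b

    choose : ∀ ν → Invariant ν → (∀ k → ν k ≡ μ k) ⊎ Choice ν
    choose ν (ν↓ , ν-vanish , ν⊴μ , total) with least (λ k → prefix ν (suc k) < prefix μ (suc k)) (λ k → prefix ν (suc k) ℕP.<? prefix μ (suc k)) L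
    ... | inj₂ never-behind = inj₁ ν≗μ
      where
      equal : ∀ k → k ≤ L → prefix ν k ≡ prefix μ k
      equal zero    _   = refl
      equal (suc k) k<L = ≤∧¬<⇒≡ (ν⊴μ (suc k)) (never-behind k k<L)
      ν≗μ : ∀ k → ν k ≡ μ k
      ν≗μ k with ℕP.<-≤-connex k L
      ... | inj₁ k<L = ℕP.+-cancelˡ-≡ (prefix ν k) _ _ (trans (equal (suc k) k<L) (cong (_+ μ k) (sym (equal k (ℕP.<⇒≤ k<L)))))
      ... | inj₂ L≤k = trans (ν-vanish k L≤k) (sym (μ-vanish k L≤k))
    ... | inj₁ (i , i<L , behind-at-i+1 , equal-before) = inj₂ (choose-j (least Equal (λ k → _ ℕP.≟ _) (L ∸ suc i)))
      where
      equal-at : ∀ i → (∀ k → k < i → ¬ prefix ν (suc k) < prefix μ (suc k)) → prefix ν i ≡ prefix μ i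
      equal-at zero     _            = refl
      equal-at (suc i′) equal-before = ≤∧¬<⇒≡ (ν⊴μ (suc i′)) (equal-before i′ (ℕP.n<1+n i′))
      1+i<L : suc i < L
      1+i<L with ℕP.m≤n⇒m<n∨m≡n i<L
      ... | inj₁ 1+i<L = 1+i<L
      ... | inj₂ 1+i≡L = contradiction (trans (cong (prefix ν) 1+i≡L) (trans total (cong (prefix μ) (sym 1+i≡L)))) (ℕP.<⇒≢ behind-at-i+1)
      Equal : ℕ → Set
      Equal d = prefix ν (suc (suc i + d)) ≡ prefix μ (suc (suc i + d))
      end : suc (suc i + (L ∸ suc (suc i))) ≡ L
      end = ℕP.m+[n∸m]≡n 1+i<L
      choose-j : (∃ λ d → d < L ∸ suc i × Equal d × (∀ d′ → d′ < d → ¬ Equal d′)) ⊎ (∀ d → d < L ∸ suc i → ¬ Equal d) → Choice ν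
      choose-j (inj₂ never-equal) =
        contradiction (trans (cong (prefix ν) end) (trans total (cong (prefix μ) (sym end))))
                      (never-equal (L ∸ suc (suc i)) (ℕP.∸-monoʳ-< (ℕP.n<1+n (suc i)) 1+i<L))
      choose-j (inj₁ (d , d<L-i-1 , equal-at-d , unequal-before)) = record
        { i = i ; j = suc i + d ; i<j = ℕP.m≤m+n (suc i) d
        ; j<L = subst (suc i + d <_) (ℕP.m+[n∸m]≡n (ℕP.<⇒≤ 1+i<L)) (ℕP.+-monoʳ-< (suc i) d<L-i-1)
        ; equal-at-i = equal-at i equal-before ; behind = behind ; equal-after = equal-at-d }
        where
        behind-at : ∀ d′ → d′ ≤ d → prefix ν (suc i + d′) < prefix μ (suc i + d′)
        behind-at zero       _     = subst (λ z → prefix ν z < prefix μ z) (sym (ℕP.+-identityʳ (suc i))) behind-at-i+1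
        behind-at (suc d′) 1+d′≤d = subst (λ z → prefix ν z < prefix μ z) (sym (ℕP.+-suc (suc i) d′))
                                          (ℕP.≤∧≢⇒< (ν⊴μ (suc (suc i + d′))) (unequal-before d′ 1+d′≤d))
        behind : ∀ k → i < k → k ≤ suc i + d → prefix ν k < prefix μ k
        behind k i<k k≤j = subst (λ z → prefix ν z < prefix μ z) (ℕP.m+[n∸m]≡n i<k)
                                 (behind-at (k ∸ suc i) (ℕP.+-cancelˡ-≤ (suc i) _ _ (subst (_≤ suc i + d) (sym (ℕP.m+[n∸m]≡n i<k)) k≤j)))

    private
      cancel-< : ∀ {a b x y} → a ≡ b → a + x < b + y → x < y
      cancel-< {a} refl a+x<a+y = ℕP.+-cancelˡ-< a _ _ a+x<a+y

      cancel-≤ : ∀ {a b x y} → a ≡ b → a + x ≤ b + y → x ≤ y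
      cancel-≤ {a} refl a+x≤a+y = ℕP.+-cancelˡ-≤ a _ _ a+x≤a+y

      compensate-< : ∀ {a b x y} → a < b → a + x ≡ b + y → y < x
      compensate-< {x = x} {y} a<b a+x≡b+y with ℕP.≤-<-connex x y
      ... | inj₁ x≤y = contradiction a+x≡b+y (ℕP.<⇒≢ (ℕP.+-mono-<-≤ a<b x≤y))
      ... | inj₂ y<x = y<x

      compensate-≤ : ∀ {a b x y} → a ≤ b → a + x ≡ b + y → y ≤ x
      compensate-≤ {x = x} {y} a≤b a+x≡b+y with ℕP.<-≤-connex x y
      ... | inj₁ x<y = contradiction a+x≡b+y (ℕP.<⇒≢ (ℕP.+-mono-≤-< a≤b x<y))
      ... | inj₂ y≤x = y≤x

    module AfterMove (ν : Seq) (ν↓ : Decreasing ν) (ν-vanish : VanishesFrom L ν) (ν⊴μ : ν ⊴ˢ μ) (total : prefix ν L ≡ prefix μ L)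
                     (ch : Choice ν) where
      open Choice ch

      private
        i≢j : i ≢ j
        i≢j = ℕP.<⇒≢ i<j

      μj<νj : μ j < ν j
      μj<νj = compensate-< (behind j i<j ℕP.≤-refl) equal-after

      νj>0 : 0 < ν j
      νj>0 = ℕP.<-≤-trans (s≤s z≤n) μj<νj

      νj≤νi : ν j ≤ ν i
      νj≤νi = Decreasing-mono ν↓ (ℕP.<⇒≤ i<j)

      ν′ : Seq
      ν′ = move ν i j

      νi<νk : ∀ k → suc k ≡ i → ν i < ν k
      νi<νk k refl = ℕP.<-≤-trans (cancel-< equal-at-i (behind (suc i) (ℕP.n<1+n i) i<j))
                                  (ℕP.≤-trans (μ↓ k) (compensate-≤ (ν⊴μ k) equal-at-i))

      νj+1<νj : ν (suc j) < ν j
      νj+1<νj = ℕP.≤-<-trans (cancel-≤ equal-after (ν⊴μ (suc (suc j)))) (ℕP.≤-<-trans (μ↓ j) μj<νj)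

      ν′↓ : Decreasing ν′
      ν′↓ k = by-cases (suc k ℕP.≟ i) (suc k ℕP.≟ j)
        where
        pred≤ : pred (ν j) ≤ ν j
        pred≤ = ℕP.pred[n]≤n
        row-above-j : suc k ≡ j → Dec (k ≡ i) → pred (ν j) ≤ ν′ k
        row-above-j 1+k≡j (yes refl) = subst (pred (ν j) ≤_) (sym (move-at-i ν i j)) (ℕP.≤-trans pred≤ (ℕP.≤-trans νj≤νi (ℕP.n≤1+n _)))
        row-above-j 1+k≡j (no k≢i)   = subst (pred (ν j) ≤_) (sym (move-elsewhere ν k≢i (ℕP.<⇒≢ (subst (k <_) 1+k≡j ℕP.≤-refl))))
                                             (ℕP.≤-trans pred≤ (subst (_≤ ν k) (cong ν 1+k≡j) (ν↓ k)))
        row-k : Dec (k ≡ i) → Dec (k ≡ j) → ν (suc k) ≤ ν′ k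
        row-k (yes refl) _          = subst (ν (suc k) ≤_) (sym (move-at-i ν i j)) (ℕP.≤-trans (ν↓ k) (ℕP.n≤1+n _))
        row-k (no _)     (yes refl) = subst (ν (suc k) ≤_) (sym (move-at-j ν i≢j)) (ℕP.<⇒≤pred νj+1<νj)
        row-k (no k≢i)   (no k≢j)   = subst (ν (suc k) ≤_) (sym (move-elsewhere ν k≢i k≢j)) (ν↓ k)
        by-cases : Dec (suc k ≡ i) → Dec (suc k ≡ j) → ν′ (suc k) ≤ ν′ k
        by-cases (yes 1+k≡i) _ =
          subst₂ _≤_ (sym (trans (cong ν′ 1+k≡i) (move-at-i ν i j)))
                     (sym (move-elsewhere ν (λ k≡i → ℕP.<⇒≢ k<i k≡i) (λ k≡j → ℕP.<⇒≢ (ℕP.<-trans k<i i<j) k≡j)))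
                     (νi<νk k 1+k≡i)
          where
          k<i : k < i
          k<i = subst (k <_) 1+k≡i ℕP.≤-refl
        by-cases (no _) (yes 1+k≡j) =
          subst (_≤ ν′ k) (sym (trans (cong ν′ 1+k≡j) (move-at-j ν i≢j))) (row-above-j 1+k≡j (k ℕP.≟ i))
        by-cases (no 1+k≢i) (no 1+k≢j) =
          subst (_≤ ν′ k) (sym (move-elsewhere ν 1+k≢i 1+k≢j)) (row-k (k ℕP.≟ i) (k ℕP.≟ j))

      ν′-vanish : VanishesFrom L ν′
      ν′-vanish k L≤k = trans (move-elsewhere ν (λ k≡i → ℕP.<⇒≢ (ℕP.<-≤-trans (ℕP.<-trans i<j j<L) L≤k) (sym k≡i))
                                                (λ k≡j → ℕP.<⇒≢ (ℕP.<-≤-trans j<L L≤k) (sym k≡j)))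
                              (ν-vanish k L≤k)

      ν′⊴μ : ν′ ⊴ˢ μ
      ν′⊴μ k with ℕP.≤-<-connex k i
      ... | inj₁ k≤i = subst (_≤ prefix μ k) (sym (prefix-move-≤i ν i<j νj>0 k k≤i)) (ν⊴μ k)
      ... | inj₂ i<k with ℕP.≤-<-connex k j
      ...   | inj₁ k≤j = subst (_≤ prefix μ k) (sym (prefix-move-between ν i<j νj>0 k i<k k≤j)) (behind k i<k k≤j)
      ...   | inj₂ j<k = subst (_≤ prefix μ k) (sym (prefix-move->j ν i<j νj>0 k j<k)) (ν⊴μ k)

      invariant : Invariant ν′
      invariant = ν′↓ , ν′-vanish , ν′⊴μ , trans (prefix-move->j ν i<j νj>0 L j<L) total

      potential-< : potential (suc L) (prefix ν) < potential (suc L) (prefix ν′)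
      potential-< = potential-mono-< (suc L) (prefix-move-≥ ν i<j νj>0) (ℕP.m<n⇒m<1+n j<L)
                      (subst (prefix ν j <_) (sym (prefix-move-between ν i<j νj>0 j i<j ℕP.≤-refl)) (ℕP.n<1+n _))

      potential-≤ : potential (suc L) (prefix ν′) ≤ potential (suc L) (prefix μ)
      potential-≤ = potential-mono (suc L) ν′⊴μ

    reach : ∀ ν → Invariant ν → P ν → P μ
    reach ν inv Pν = go (suc (gap ν)) ν inv (ℕP.n<1+n _) Pν
      where
      gap : Seq → ℕ
      gap ν = potential (suc L) (prefix μ) ∸ potential (suc L) (prefix ν)
      go : ∀ fuel ν → Invariant ν → gap ν < fuel → P ν → P μ
      go (suc fuel) ν inv@(ν↓ , ν-vanish , ν⊴μ , total) gap<fuel Pν with choose ν inv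
      ... | inj₁ ν≗μ = P-ext ν μ ν≗μ Pν
      ... | inj₂ ch  = go fuel ν′ invariant (ℕP.<-≤-trans (ℕP.∸-monoʳ-< potential-< potential-≤) (ℕP.≤-pred gap<fuel))
                          (P-move ν i<j νj>0 νj≤νi Pν)
        where
        open AfterMove ν ν↓ ν-vanish ν⊴μ total ch
        open Choice ch using (i<j)

  nth-decreasing : ∀ ν → IsPartition ν → Decreasing (nth ν)
  nth-decreasing []           _          k       = z≤n
  nth-decreasing (x ∷ [])     _          k       = z≤n
  nth-decreasing (x ∷ y ∷ ν)  (x≥y ∷ _)  zero    = x≥y
  nth-decreasing (x ∷ y ∷ ν)  (_ ∷ ν↓)   (suc k) = nth-decreasing (y ∷ ν) ν↓ k

  nth-vanishes : ∀ ν {L} → length ν ≤ L → VanishesFrom L (nth ν)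
  nth-vanishes ν len≤L k L≤k = nth-beyond ν (ℕP.≤-trans len≤L L≤k)

  prefix-nth : ∀ ν k → prefix (nth ν) k ≡ sum (take k ν)
  prefix-nth ν       zero    = refl
  prefix-nth []      (suc k) = trans (ℕP.+-identityʳ _) (trans (prefix-nth [] k) (cong sum (take-[] k)))
    where
    take-[] : ∀ k → take {A = ℕ} k [] ≡ []
    take-[] zero    = refl
    take-[] (suc k) = refl
  prefix-nth (x ∷ ν) (suc k) = trans (prefix-cons k) (cong (x +_) (prefix-nth ν k))
    where
    prefix-cons : ∀ k → prefix (nth (x ∷ ν)) (suc k) ≡ x + prefix (nth ν) k
    prefix-cons zero    = ℕP.+-comm 0 x
    prefix-cons (suc k) = trans (cong (_+ nth ν k) (prefix-cons k)) (ℕP.+-assoc x (prefix (nth ν) k) (nth ν k))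

  prefix-nth-total : ∀ ν {L} → length ν ≤ L → prefix (nth ν) L ≡ size ν
  prefix-nth-total ν {L} len≤L = trans (prefix-nth ν L) (cong sum (ListP.take-all L ν len≤L))

  ⊴-transport : (P : Seq → Set) → (∀ ν ν′ → (∀ k → ν k ≡ ν′ k) → P ν → P ν′) →
                (∀ ν {i j} → i < j → 0 < ν j → ν j ≤ ν i → P ν → P (move ν i j)) →
                ∀ {ν μ} → IsPartition ν → IsPartition μ → size ν ≡ size μ → ν ⊴ μ → P (nth ν) → P (nth μ)
  ⊴-transport P P-ext P-move {ν} {μ} ν↓ μ↓ |ν|≡|μ| ν⊴μ =
    Chain.reach (nth μ) L (nth-decreasing μ μ↓) (nth-vanishes μ (ℕP.m≤n⊔m (length ν) (length μ))) P P-ext P-move (nth ν)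
      ( nth-decreasing ν ν↓
      , nth-vanishes ν (ℕP.m≤m⊔n (length ν) (length μ))
      , (λ k → subst₂ _≤_ (sym (prefix-nth ν k)) (sym (prefix-nth μ k)) (ν⊴μ k))
      , trans (prefix-nth-total ν (ℕP.m≤m⊔n (length ν) (length μ)))
              (trans |ν|≡|μ| (sym (prefix-nth-total μ (ℕP.m≤n⊔m (length ν) (length μ))))))
    where
    L : ℕ
    L = length ν ℕ.⊔ length μ

module BoxMoves where

  open import Defs
  open Counting
  open BooleanLattice using (card; _⊆ᵇ_; ⊆ᵇ-sound; ⊆ᵇ-complete; Σ↑ℕ; φ↑; Σ↑ℕ-constant⇒constant; Σ↑ℕ-1+card)
  open import Data.Nat as ℕ using (ℕ; suc; _+_; _*_; _<_; _≤_; _∸_; s≤s)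
  import Data.Nat.Properties as ℕP
  open import Data.Nat.DivMod using (_/_; m*n/n≡m; m≥n⇒m/n>0)
  open import Data.Fin as Fin using (Fin)
  import Data.Fin.Properties as FinP
  open import Data.Fin.Permutation using (_⟨$⟩ʳ_; _⟨$⟩ˡ_; inverseˡ)
  open import Data.Bool as Bool using (Bool; true; false; if_then_else_)
  open import Data.Vec using (Vec; lookup; tabulate; _[_]≔_)
  import Data.Vec.Properties as VecP
  open import Data.Vec.Functional using (updateAt)
  open import Data.Vec.Functional.Properties using (updateAt-updates; updateAt-minimal)
  open import Data.List using (List)
  open import Data.Product using (∃; _×_; _,_; proj₁; proj₂)
  import Data.Product.Properties as ProdP
  open import Data.Sum using (_⊎_; inj₁; inj₂)
  import Data.Sum.Properties as SumP
  open import Relation.Nullary using (¬_; Dec; yes; no; does; contradiction)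
  open import Relation.Nullary.Decidable using (_×-dec_; _⊎-dec_; dec-true)
  open import Relation.Binary.Definitions using (DecidableEquality)
  open import Relation.Binary.PropositionalEquality
  open import Algebra.Properties.Semiring.Sum ℕP.+-*-semiring using (sum-syntax; sum-cong-≗; ∑-distrib-+; *-distribˡ-sum)

  data Side : Set where
    σ-side ρ-side : Side

  Row : Set
  Row = Side × ℕ

  _≟ᴿ_ : DecidableEquality Row
  _≟ᴿ_ = ProdP.≡-dec _≟ˢ_ ℕ._≟_
    where
    _≟ˢ_ : DecidableEquality Side
    σ-side ≟ˢ σ-side = yes refl
    σ-side ≟ˢ ρ-side = no λ ()
    ρ-side ≟ˢ σ-side = no λ ()
    ρ-side ≟ˢ ρ-side = yes refl

  shapeOf : (ℕ → ℕ) → (ℕ → ℕ) → Row → ℕ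
  shapeOf ν ν′ (σ-side , r) = ν r
  shapeOf ν ν′ (ρ-side , r) = ν′ r

  -- A cell in a σ-row records its row and a coset of {0}, i.e. an element of G;
  -- a cell in a ρ-row records its row only (G/G is a point).
  Cell : ℕ → Set
  Cell m = (ℕ × Fin m) ⊎ ℕ

  pattern σ-cell r c = inj₁ (r , c)
  pattern ρ-cell r   = inj₂ r

  module _ {m : ℕ} where

    _≟ᶜ_ : DecidableEquality (Cell m)
    _≟ᶜ_ = SumP.≡-dec (ProdP.≡-dec ℕ._≟_ FinP._≟_) ℕ._≟_

    rowOf : Cell m → Row
    rowOf (σ-cell r _) = σ-side , r
    rowOf (ρ-cell r)   = ρ-side , r

    moveTo : ℕ → Cell m → Cell m
    moveTo r (σ-cell _ c) = σ-cell r c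
    moveTo r (ρ-cell _)   = ρ-cell r

    rowOf-moveTo : ∀ r e → rowOf (moveTo r e) ≡ (proj₁ (rowOf e) , r)
    rowOf-moveTo r (σ-cell _ _) = refl
    rowOf-moveTo r (ρ-cell _)   = refl

    moveTo-moveTo : ∀ r r′ e → moveTo r (moveTo r′ e) ≡ moveTo r e
    moveTo-moveTo r r′ (σ-cell _ _) = refl
    moveTo-moveTo r r′ (ρ-cell _)   = refl

    moveTo-id : ∀ {s r} e → rowOf e ≡ (s , r) → moveTo r e ≡ e
    moveTo-id (σ-cell _ _) refl = refl
    moveTo-id (ρ-cell _)   refl = refl

  record BoxMove (shp shp′ : Row → ℕ) : Set where
    field
      side     : Side
      to from  : ℕ
      to≢from  : to ≢ from
      gain     : shp′ (side , to) ≡ suc (shp (side , to))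
      loss     : shp (side , from) ≡ suc (shp′ (side , from))
      rest     : ∀ k → k ≢ (side , to) → k ≢ (side , from) → shp′ k ≡ shp k

    rowTo rowFrom : Row
    rowTo   = side , to
    rowFrom = side , from

  module Configurations {m n : ℕ} (_⊕_ : Fin m → Fin m → Fin m) where

    Config : Set
    Config = Fin n → Cell m

    shift : Fin m → Cell m → Cell m
    shift g (σ-cell r c) = σ-cell r (c ⊕ g)
    shift g (ρ-cell r)   = ρ-cell r

    rowOf-shift : ∀ g e → rowOf (shift g e) ≡ rowOf e
    rowOf-shift g (σ-cell _ _) = refl
    rowOf-shift g (ρ-cell _)   = refl

    shift-moveTo : ∀ g r e → shift g (moveTo r e) ≡ moveTo r (shift g e)
    shift-moveTo g r (σ-cell _ _) = refl
    shift-moveTo g r (ρ-cell _)   = refl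

    _·_ : Wreath m n → Fin n → Fin n
    y · i = perm y ⟨$⟩ʳ i

    ·-injective : ∀ y {i j} → y · i ≡ y · j → i ≡ j
    ·-injective y {i} {j} y·i≡y·j = trans (sym (inverseˡ (perm y))) (trans (cong (perm y ⟨$⟩ˡ_) y·i≡y·j) (inverseˡ (perm y)))

    Maps : Wreath m n → Config → Config → Set
    Maps y f h = ∀ i → h (y · i) ≡ shift (vec y (y · i)) (f i)

    Maps? : ∀ f h y → Dec (Maps y f h)
    Maps? f h y = FinP.all? (λ i → h (y · i) ≟ᶜ shift (vec y (y · i)) (f i))

    Maps-cong : ∀ {y f f′ h h′} → (∀ i → f i ≡ f′ i) → (∀ i → h i ≡ h′ i) → Maps y f h → Maps y f′ h′
    Maps-cong f≗f′ h≗h′ y∶f↦h i = trans (sym (h≗h′ _)) (trans (y∶f↦h i) (cong (shift _) (f≗f′ i)))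

    rowCount : Config → Row → ℕ
    rowCount f k = ∑[ i < n ] 𝟙 (rowOf (f i) ≟ᴿ k)

    HasShape : (Row → ℕ) → Config → Set
    HasShape shp f = ∀ k → rowCount f k ≡ shp k

    ConfigTransitive : (Row → ℕ) → List (Wreath m n) → Set
    ConfigTransitive shp Y =
      ∃ λ c → 0 < c × (∀ f h → HasShape shp f → HasShape shp h → CountIs (λ y → Maps y f h) Y c)

    ConfigTransitive-cong : ∀ {shp shp′} Y → (∀ k → shp k ≡ shp′ k) → ConfigTransitive shp Y → ConfigTransitive shp′ Y
    ConfigTransitive-cong Y shp≗shp′ (c , c>0 , counts) =
      c , c>0 , λ f h f∶shp′ h∶shp′ → counts f h (λ k → trans (f∶shp′ k) (sym (shp≗shp′ k))) (λ k → trans (h∶shp′ k) (sym (shp≗shp′ k)))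

    -- For f₁, h₁ of the new shape, v A = #{y ∈ Y : y maps build A to h₁} has constant
    -- up-sums (Σ↑v≡), so v, and with it #{y ∈ Y : y maps f₁ to h₁}, is constant.
    module MoveCount {shp shp′ : Row → ℕ} (mv : BoxMove shp shp′) (Y : List (Wreath m n)) (c : ℕ)
                     (counts : ∀ f h → HasShape shp f → HasShape shp h → count (Maps? f h) Y ≡ c)
                     (f₁ h₁ : Config) (f₁-shape : HasShape shp′ f₁) (h₁-shape : HasShape shp′ h₁) where
      open BoxMove mv

      b : ℕ
      b = shp rowTo

      rowTo≢rowFrom : rowTo ≢ rowFrom
      rowTo≢rowFrom rowTo≡rowFrom = to≢from (cong proj₂ rowTo≡rowFrom)

      Moved : Cell m → Set
      Moved e = rowOf e ≡ rowTo ⊎ rowOf e ≡ rowFrom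

      moved? : ∀ e → Dec (Moved e)
      moved? e = (rowOf e ≟ᴿ rowTo) ⊎-dec (rowOf e ≟ᴿ rowFrom)

      side-moved : ∀ {e} → Moved e → proj₁ (rowOf e) ≡ side
      side-moved (inj₁ e∈rowTo) = cong proj₁ e∈rowTo
      side-moved (inj₂ e∈rowFrom) = cong proj₁ e∈rowFrom

      M : Vec Bool n
      M = tabulate (λ t → does (moved? (f₁ t)))

      lookup-M : ∀ t → lookup M t ≡ does (moved? (f₁ t))
      lookup-M = VecP.lookup∘tabulate (λ t → does (moved? (f₁ t)))

      M-true : ∀ t → lookup M t ≡ true → Moved (f₁ t)
      M-true t t∈M = does-true (moved? (f₁ t)) (trans (sym (lookup-M t)) t∈M)

      M-false : ∀ t → lookup M t ≡ false → ¬ Moved (f₁ t)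
      M-false t t∉M = does-false (moved? (f₁ t)) (trans (sym (lookup-M t)) t∉M)

      card-M : card M ≡ shp′ rowTo + shp′ rowFrom
      card-M = begin
        card M
          ≡⟨ sum-cong-≗ (λ t → cong (λ x → if x then 1 else 0) (lookup-M t)) ⟩
        ∑[ t < n ] (if does (moved? (f₁ t)) then 1 else 0)
          ≡⟨ sum-cong-≗ (λ t → trans (if-does (moved? (f₁ t))) (𝟙-⊎-dec exclusive (rowOf (f₁ t) ≟ᴿ rowTo) (rowOf (f₁ t) ≟ᴿ rowFrom))) ⟩
        ∑[ t < n ] (𝟙 (rowOf (f₁ t) ≟ᴿ rowTo) + 𝟙 (rowOf (f₁ t) ≟ᴿ rowFrom))
          ≡⟨ ∑-distrib-+ (λ t → 𝟙 (rowOf (f₁ t) ≟ᴿ rowTo)) (λ t → 𝟙 (rowOf (f₁ t) ≟ᴿ rowFrom)) ⟩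
        rowCount f₁ rowTo + rowCount f₁ rowFrom
          ≡⟨ cong₂ _+_ (f₁-shape rowTo) (f₁-shape rowFrom) ⟩
        shp′ rowTo + shp′ rowFrom ∎
        where
        open ≡-Reasoning
        exclusive : ∀ {e} → rowOf e ≡ rowTo → rowOf e ≢ rowFrom
        exclusive e∈rowTo e∈rowFrom = rowTo≢rowFrom (trans (sym e∈rowTo) e∈rowFrom)

      build : Vec Bool n → Config
      build A t = if lookup M t then moveTo (if lookup A t then to else from) (f₁ t) else f₁ t

      rowOf-moveTo-M : ∀ t r → lookup M t ≡ true → rowOf (moveTo r (f₁ t)) ≡ (side , r)
      rowOf-moveTo-M t r t∈M = trans (rowOf-moveTo r (f₁ t)) (cong (_, r) (side-moved (M-true t t∈M)))

      rowOf-build≡rowFrom : ∀ A t → rowOf (build A t) ≡ rowFrom → lookup M t ≡ true × lookup A t ≡ false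
      rowOf-build≡rowFrom A t row≡rowFrom with lookup M t in t∈M | lookup A t
      ... | false | _     = contradiction (inj₂ row≡rowFrom) (M-false t t∈M)
      ... | true  | false = refl , refl
      ... | true  | true  = contradiction (trans (sym (rowOf-moveTo-M t to t∈M)) row≡rowFrom) rowTo≢rowFrom

      𝟙-build-rowTo : ∀ B → B ⊆ᵇ M ≡ true → ∀ t → 𝟙 (rowOf (build B t) ≟ᴿ rowTo) ≡ (if lookup B t then 1 else 0)
      𝟙-build-rowTo B B⊆M t with lookup M t in t∈M | lookup B t in t∈B
      ... | true  | true  = 𝟙-yes (rowOf-moveTo-M t to t∈M) _
      ... | true  | false = 𝟙-no (λ p → rowTo≢rowFrom (trans (sym p) (rowOf-moveTo-M t from t∈M))) _
      ... | false | true  = contradiction (trans (sym (⊆ᵇ-sound B M B⊆M t t∈B)) t∈M) λ ()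
      ... | false | false = 𝟙-no (λ p → M-false t t∈M (inj₁ p)) _

      𝟙-build-rowFrom : ∀ B t → 𝟙 (rowOf (build B t) ≟ᴿ rowFrom) ≡ (if φ↑ (lookup M t) (lookup B t) then 1 else 0)
      𝟙-build-rowFrom B t with lookup M t in t∈M | lookup B t
      ... | true  | true  = 𝟙-no (λ p → rowTo≢rowFrom (trans (sym (rowOf-moveTo-M t to t∈M)) p)) _
      ... | true  | false = 𝟙-yes (rowOf-moveTo-M t from t∈M) _
      ... | false | _     = 𝟙-no (λ p → M-false t t∈M (inj₂ p)) _

      moved-row≢ : ∀ {e k} → k ≢ rowTo → k ≢ rowFrom → Moved e → rowOf e ≢ k
      moved-row≢ k≢rowTo k≢rowFrom (inj₁ p) q = k≢rowTo (trans (sym q) p)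
      moved-row≢ k≢rowTo k≢rowFrom (inj₂ p) q = k≢rowFrom (trans (sym q) p)

      𝟙-build-other : ∀ B k → k ≢ rowTo → k ≢ rowFrom → ∀ t → 𝟙 (rowOf (build B t) ≟ᴿ k) ≡ 𝟙 (rowOf (f₁ t) ≟ᴿ k)
      𝟙-build-other B k k≢rowTo k≢rowFrom t with lookup M t in t∈M | lookup B t
      ... | false | _     = refl
      ... | true  | true  = trans (𝟙-no (λ p → k≢rowTo (trans (sym p) (rowOf-moveTo-M t to t∈M))) _)
                                  (sym (𝟙-no (moved-row≢ k≢rowTo k≢rowFrom (M-true t t∈M)) _))
      ... | true  | false = trans (𝟙-no (λ p → k≢rowFrom (trans (sym p) (rowOf-moveTo-M t from t∈M))) _)
                                  (sym (𝟙-no (moved-row≢ k≢rowTo k≢rowFrom (M-true t t∈M)) _))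

      build-shape : ∀ B → B ⊆ᵇ M ≡ true → card B ≡ b → HasShape shp (build B)
      build-shape B B⊆M |B|≡b k with k ≟ᴿ rowTo | k ≟ᴿ rowFrom
      ... | yes refl | _        = trans (sum-cong-≗ (𝟙-build-rowTo B B⊆M)) |B|≡b
      ... | no _     | yes refl = trans (sum-cong-≗ (𝟙-build-rowFrom B)) (ℕP.+-cancelʳ-≡ b _ _ free+b≡)
        where
        open ≡-Reasoning
        free+b≡ : Σ↑ℕ M (λ _ → 1) B + b ≡ shp rowFrom + b
        free+b≡ = begin
          Σ↑ℕ M (λ _ → 1) B + b       ≡⟨ cong (Σ↑ℕ M (λ _ → 1) B +_) |B|≡b ⟨
          Σ↑ℕ M (λ _ → 1) B + card B  ≡⟨ Σ↑ℕ-1+card M B B⊆M ⟩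
          card M                      ≡⟨ card-M ⟩
          shp′ rowTo + shp′ rowFrom           ≡⟨ cong (_+ shp′ rowFrom) gain ⟩
          suc b + shp′ rowFrom             ≡⟨ cong suc (ℕP.+-comm b (shp′ rowFrom)) ⟩
          suc (shp′ rowFrom) + b           ≡⟨ cong (_+ b) loss ⟨
          shp rowFrom + b                  ∎
      ... | no k≢rowTo  | no k≢rowFrom  = trans (sum-cong-≗ (𝟙-build-other B k k≢rowTo k≢rowFrom)) (trans (f₁-shape k) (rest k k≢rowTo k≢rowFrom))

      down : Fin n → Config
      down q = updateAt h₁ q (moveTo from)

      rowOf-down : ∀ q → rowOf (h₁ q) ≡ rowTo → rowOf (down q q) ≡ rowFrom
      rowOf-down q q∈rowTo = trans (cong rowOf (updateAt-updates q h₁)) (trans (rowOf-moveTo from (h₁ q)) (cong (λ k → proj₁ k , from) q∈rowTo))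

      down-shape : ∀ q → rowOf (h₁ q) ≡ rowTo → HasShape shp (down q)
      down-shape q q∈rowTo k = ℕP.+-cancelʳ-≡ (𝟙 (rowOf (h₁ q) ≟ᴿ k)) _ _ (trans swap-q (by-row k))
        where
        swap-q : rowCount (down q) k + 𝟙 (rowOf (h₁ q) ≟ᴿ k) ≡ rowCount h₁ k + 𝟙 (rowOf (down q q) ≟ᴿ k)
        swap-q = ∑-update (λ t → 𝟙 (rowOf (down q t) ≟ᴿ k)) (λ t → 𝟙 (rowOf (h₁ t) ≟ᴿ k)) q
                          (λ t t≢q → cong (λ e → 𝟙 (rowOf e ≟ᴿ k)) (updateAt-minimal t q h₁ t≢q))
        by-row : ∀ k → rowCount h₁ k + 𝟙 (rowOf (down q q) ≟ᴿ k) ≡ shp k + 𝟙 (rowOf (h₁ q) ≟ᴿ k)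
        by-row k with k ≟ᴿ rowTo | k ≟ᴿ rowFrom
        ... | yes refl | _ = begin
          rowCount h₁ rowTo + 𝟙 (rowOf (down q q) ≟ᴿ rowTo)
            ≡⟨ cong₂ _+_ (h₁-shape rowTo) (𝟙-no (λ p → rowTo≢rowFrom (trans (sym p) (rowOf-down q q∈rowTo))) _) ⟩
          shp′ rowTo + 0
            ≡⟨ trans (ℕP.+-identityʳ _) (trans gain (ℕP.+-comm 1 b)) ⟩
          b + 1
            ≡⟨ cong (b +_) (𝟙-yes q∈rowTo _) ⟨
          b + 𝟙 (rowOf (h₁ q) ≟ᴿ rowTo) ∎
          where open ≡-Reasoning
        ... | no _ | yes refl = begin
          rowCount h₁ rowFrom + 𝟙 (rowOf (down q q) ≟ᴿ rowFrom)
            ≡⟨ cong₂ _+_ (h₁-shape rowFrom) (𝟙-yes (rowOf-down q q∈rowTo) _) ⟩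
          shp′ rowFrom + 1
            ≡⟨ trans (ℕP.+-comm (shp′ rowFrom) 1) (trans (sym loss) (sym (ℕP.+-identityʳ _))) ⟩
          shp rowFrom + 0
            ≡⟨ cong (shp rowFrom +_) (𝟙-no (λ p → rowTo≢rowFrom (trans (sym q∈rowTo) p)) _) ⟨
          shp rowFrom + 𝟙 (rowOf (h₁ q) ≟ᴿ rowFrom) ∎
          where open ≡-Reasoning
        ... | no k≢rowTo | no k≢rowFrom =
          cong₂ _+_ (trans (h₁-shape k) (rest k k≢rowTo k≢rowFrom))
                    (trans (𝟙-no (λ p → k≢rowFrom (trans (sym p) (rowOf-down q q∈rowTo))) _) (sym (𝟙-no (λ p → k≢rowTo (trans (sym p) q∈rowTo)) _)))

      module _ (B : Vec Bool n) (t : Fin n) (t∈M∖B : φ↑ (lookup M t) (lookup B t) ≡ true) where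

        private
          t∈M×t∉B : lookup M t ≡ true × lookup B t ≡ false
          t∈M×t∉B with lookup M t | lookup B t
          t∈M×t∉B | true | false = refl , refl

        build-insert-at : build (B [ t ]≔ true) t ≡ moveTo to (f₁ t)
        build-insert-at rewrite proj₁ t∈M×t∉B | VecP.lookup∘update t B true = refl

        build-at : build B t ≡ moveTo from (f₁ t)
        build-at rewrite proj₁ t∈M×t∉B | proj₂ t∈M×t∉B = refl

        rowOf-build-insert-at : rowOf (build (B [ t ]≔ true) t) ≡ rowTo
        rowOf-build-insert-at = trans (cong rowOf build-insert-at) (rowOf-moveTo-M t to (proj₁ t∈M×t∉B))

      build-insert-elsewhere : ∀ B {t} i → i ≢ t → build (B [ t ]≔ true) i ≡ build B i
      build-insert-elsewhere B i i≢t =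
        cong (λ x → if lookup M i then moveTo (if x then to else from) (f₁ i) else f₁ i) (VecP.lookup∘update′ i≢t B true)

      MapsUp : Vec Bool n → Fin n → Wreath m n → Set
      MapsUp B t y = φ↑ (lookup M t) (lookup B t) ≡ true × Maps y (build (B [ t ]≔ true)) h₁

      MapsDown : Vec Bool n → Fin n → Wreath m n → Set
      MapsDown B q y = rowOf (h₁ q) ≡ rowTo × Maps y (build B) (down q)

      MapsUp? : ∀ B t y → Dec (MapsUp B t y)
      MapsUp? B t y = (φ↑ (lookup M t) (lookup B t) Bool.≟ true) ×-dec Maps? (build (B [ t ]≔ true)) h₁ y

      MapsDown? : ∀ B q y → Dec (MapsDown B q y)
      MapsDown? B q y = (rowOf (h₁ q) ≟ᴿ rowTo) ×-dec Maps? (build B) (down q) y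

      -- Moving the image q = y · t of the inserted cell down to row `from` turns one into the other.
      MapsUp⇒MapsDown : ∀ B t y → MapsUp B t y → MapsDown B (y · t) y
      MapsUp⇒MapsDown B t y (t∈M∖B , maps) = q∈rowTo , maps′
        where
        q : Fin n
        q = y · t
        g : Fin m
        g = vec y q
        q∈rowTo : rowOf (h₁ q) ≡ rowTo
        q∈rowTo = trans (cong rowOf (maps t)) (trans (rowOf-shift g _) (rowOf-build-insert-at B t t∈M∖B))
        maps′ : Maps y (build B) (down q)
        maps′ i with i FinP.≟ t
        ... | yes refl = begin
          down q q                                       ≡⟨ updateAt-updates q h₁ ⟩
          moveTo from (h₁ q)                             ≡⟨ cong (moveTo from) (maps t) ⟩
          moveTo from (shift g (build (B [ t ]≔ true) t)) ≡⟨ cong (λ e → moveTo from (shift g e)) (build-insert-at B t t∈M∖B) ⟩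
          moveTo from (shift g (moveTo to (f₁ t)))       ≡⟨ cong (moveTo from) (shift-moveTo g to (f₁ t)) ⟩
          moveTo from (moveTo to (shift g (f₁ t)))       ≡⟨ moveTo-moveTo from to (shift g (f₁ t)) ⟩
          moveTo from (shift g (f₁ t))                   ≡⟨ shift-moveTo g from (f₁ t) ⟨
          shift g (moveTo from (f₁ t))                   ≡⟨ cong (shift g) (build-at B t t∈M∖B) ⟨
          shift g (build B t)                            ∎
          where open ≡-Reasoning
        ... | no i≢t = trans (updateAt-minimal (y · i) q h₁ (λ p → i≢t (·-injective y p)))
                             (trans (maps i) (cong (shift _) (build-insert-elsewhere B i i≢t)))

      MapsDown⇒MapsUp : ∀ B t y → MapsDown B (y · t) y → MapsUp B t y
      MapsDown⇒MapsUp B t y (q∈rowTo , maps) = t∈M∖B , maps′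
        where
        q : Fin n
        q = y · t
        g : Fin m
        g = vec y q
        t∈M∖B : φ↑ (lookup M t) (lookup B t) ≡ true
        t∈M∖B with rowOf-build≡rowFrom B t (trans (sym (rowOf-shift g (build B t))) (trans (cong rowOf (sym (maps t))) (rowOf-down q q∈rowTo)))
        ... | t∈M , t∉B rewrite t∈M | t∉B = refl
        maps′ : Maps y (build (B [ t ]≔ true)) h₁
        maps′ i with i FinP.≟ t
        ... | yes refl = begin
          h₁ q                                  ≡⟨ moveTo-id (h₁ q) q∈rowTo ⟨
          moveTo to (h₁ q)                      ≡⟨ moveTo-moveTo to from (h₁ q) ⟨
          moveTo to (moveTo from (h₁ q))        ≡⟨ cong (moveTo to) (updateAt-updates q h₁) ⟨
          moveTo to (down q q)                  ≡⟨ cong (moveTo to) (maps t) ⟩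
          moveTo to (shift g (build B t))       ≡⟨ cong (λ e → moveTo to (shift g e)) (build-at B t t∈M∖B) ⟩
          moveTo to (shift g (moveTo from (f₁ t))) ≡⟨ cong (moveTo to) (shift-moveTo g from (f₁ t)) ⟩
          moveTo to (moveTo from (shift g (f₁ t))) ≡⟨ moveTo-moveTo to from (shift g (f₁ t)) ⟩
          moveTo to (shift g (f₁ t))            ≡⟨ shift-moveTo g to (f₁ t) ⟨
          shift g (moveTo to (f₁ t))            ≡⟨ cong (shift g) (build-insert-at B t t∈M∖B) ⟨
          shift g (build (B [ t ]≔ true) t)     ∎
          where open ≡-Reasoning
        ... | no i≢t = trans (sym (updateAt-minimal (y · i) q h₁ (λ p → i≢t (·-injective y p))))
                             (trans (maps i) (cong (shift _) (sym (build-insert-elsewhere B i i≢t))))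

      v : Vec Bool n → ℕ
      v A = count (Maps? (build A) h₁) Y

      Σ↑v≡ : ∀ B → B ⊆ᵇ M ≡ true → card B ≡ b → Σ↑ℕ M v B ≡ suc b * c
      Σ↑v≡ B B⊆M |B|≡b = begin
        Σ↑ℕ M v B                                       ≡⟨ sum-cong-≗ up-count ⟨
        ∑[ t < n ] count (MapsUp? B t) Y                ≡⟨ ∑-count-permute (MapsUp? B) (MapsDown? B) perm (MapsUp⇒MapsDown B) (MapsDown⇒MapsUp B) Y ⟩
        ∑[ q < n ] count (MapsDown? B q) Y              ≡⟨ sum-cong-≗ down-count ⟩
        ∑[ q < n ] (c * 𝟙 (rowOf (h₁ q) ≟ᴿ rowTo))         ≡⟨ *-distribˡ-sum c (λ q → 𝟙 (rowOf (h₁ q) ≟ᴿ rowTo)) ⟨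
        c * rowCount h₁ rowTo                              ≡⟨ cong (c *_) (trans (h₁-shape rowTo) gain) ⟩
        c * suc b                                       ≡⟨ ℕP.*-comm c (suc b) ⟩
        suc b * c                                       ∎
        where
        open ≡-Reasoning
        up-count : ∀ t → count (MapsUp? B t) Y ≡ (if φ↑ (lookup M t) (lookup B t) then v (B [ t ]≔ true) else 0)
        up-count t = trans (count-guard (φ↑ (lookup M t) (lookup B t) Bool.≟ true) (Maps? (build (B [ t ]≔ true)) h₁) Y)
                           (𝟙-≟true-* (φ↑ (lookup M t) (lookup B t)) (v (B [ t ]≔ true)))
        down-count : ∀ q → count (MapsDown? B q) Y ≡ c * 𝟙 (rowOf (h₁ q) ≟ᴿ rowTo)
        down-count q with count-guard (rowOf (h₁ q) ≟ᴿ rowTo) (Maps? (build B) (down q)) Y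
        ... | guarded with rowOf (h₁ q) ≟ᴿ rowTo
        ... | yes q∈rowTo =
          trans guarded (trans (ℕP.*-identityˡ _)
                               (trans (counts (build B) (down q) (build-shape B B⊆M |B|≡b) (down-shape q q∈rowTo)) (sym (ℕP.*-identityʳ c))))
        ... | no _     = trans guarded (sym (ℕP.*-zeroʳ c))

      A₀ : Vec Bool n
      A₀ = tabulate (λ t → does (rowOf (f₁ t) ≟ᴿ rowTo))

      lookup-A₀ : ∀ t → lookup A₀ t ≡ does (rowOf (f₁ t) ≟ᴿ rowTo)
      lookup-A₀ = VecP.lookup∘tabulate (λ t → does (rowOf (f₁ t) ≟ᴿ rowTo))

      A₀⊆M : A₀ ⊆ᵇ M ≡ true
      A₀⊆M = ⊆ᵇ-complete A₀ M λ t t∈A₀ →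
        trans (lookup-M t) (dec-true (moved? (f₁ t)) (inj₁ (does-true (rowOf (f₁ t) ≟ᴿ rowTo) (trans (sym (lookup-A₀ t)) t∈A₀))))

      |A₀|≡b+1 : card A₀ ≡ suc b
      |A₀|≡b+1 = trans (sum-cong-≗ (λ t → trans (cong (λ x → if x then 1 else 0) (lookup-A₀ t)) (if-does (rowOf (f₁ t) ≟ᴿ rowTo))))
                       (trans (f₁-shape rowTo) gain)

      build-A₀ : ∀ t → build A₀ t ≡ f₁ t
      build-A₀ t with lookup M t in t∈M
      ... | false = refl
      ... | true rewrite lookup-A₀ t with rowOf (f₁ t) ≟ᴿ rowTo
      ...   | yes t∈rowTo = moveTo-id (f₁ t) t∈rowTo
      ...   | no t∉rowTo with M-true t t∈M
      ...     | inj₁ t∈rowTo = contradiction t∈rowTo t∉rowTo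
      ...     | inj₂ t∈rowFrom = moveTo-id (f₁ t) t∈rowFrom

      count≡ : shp′ rowFrom < shp′ rowTo → suc (shp′ rowFrom) * count (Maps? f₁ h₁) Y ≡ suc b * c
      count≡ fewer = begin
        suc (shp′ rowFrom) * count (Maps? f₁ h₁) Y ≡⟨ cong₂ _*_ |M|-b v≡ ⟨
        (card M ∸ b) * v A₀                   ≡⟨ Σ↑ℕ-constant⇒constant M b (suc b * c) v |M|≤2b+1 Σ↑v≡ A₀ A₀⊆M |A₀|≡b+1 ⟩
        suc b * c                             ∎
        where
        open ≡-Reasoning
        v≡ : v A₀ ≡ count (Maps? f₁ h₁) Y
        v≡ = count-cong (Maps? (build A₀) h₁) (Maps? f₁ h₁)
                        (λ y → Maps-cong {y} {h = h₁} build-A₀ (λ _ → refl)) (λ y → Maps-cong {y} {h = h₁} (λ t → sym (build-A₀ t)) (λ _ → refl)) Y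
        |M|≡ : card M ≡ suc (shp′ rowFrom) + b
        |M|≡ = trans card-M (trans (cong (_+ shp′ rowFrom) gain) (cong suc (ℕP.+-comm b (shp′ rowFrom))))
        |M|-b : card M ∸ b ≡ suc (shp′ rowFrom)
        |M|-b = trans (cong (_∸ b) |M|≡) (ℕP.m+n∸n≡m (suc (shp′ rowFrom)) b)
        |M|≤2b+1 : card M ≤ suc (b + b)
        |M|≤2b+1 = subst (_≤ suc (b + b)) (sym |M|≡) (s≤s (ℕP.+-monoˡ-≤ b (ℕP.≤-pred (subst (shp′ rowFrom <_) gain fewer))))

    step : ∀ {shp shp′} (mv : BoxMove shp shp′) → shp′ (BoxMove.rowFrom mv) < shp′ (BoxMove.rowTo mv) →
           ∀ Y → ConfigTransitive shp Y → ConfigTransitive shp′ Y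
    step {shp} {shp′} mv fewer Y (c , c>0 , counts) =
      c′ , c′>0 , λ f h f∶shp′ h∶shp′ → subst (CountIs _ Y) (count≡c′ f h f∶shp′ h∶shp′) (CountIs-count (Maps? f h) Y)
      where
      open BoxMove mv
      d c′ : ℕ
      d = suc (shp′ rowFrom)
      c′ = (suc (shp rowTo) * c) / d
      count≡c′ : ∀ f h → HasShape shp′ f → HasShape shp′ h → count (Maps? f h) Y ≡ c′
      count≡c′ f h f∶shp′ h∶shp′ = sym (trans (cong (_/ d) (trans (sym d*N≡) (ℕP.*-comm d _))) (m*n/n≡m _ d))
        where
        d*N≡ : d * count (Maps? f h) Y ≡ suc (shp rowTo) * c
        d*N≡ = MoveCount.count≡ mv Y c (λ f h f∶shp h∶shp → CountIs⇒count≡ (Maps? f h) (counts f h f∶shp h∶shp)) f h f∶shp′ h∶shp′ fewer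
      c′>0 : 0 < c′
      c′>0 = m≥n⇒m/n>0 (ℕP.≤-trans (subst (d ≤_) gain fewer) (ℕP.m≤m*n (suc (shp rowTo)) c {{ℕ.>-nonZero c>0}}))

module TabloidEncoding where

  open import Defs
  open Counting
  open BoxMoves
  open Dominance using (nth; nth-lookup; nth-beyond; nth>0⇒<)
  open import Data.Nat as ℕ using (ℕ; zero; suc; _+_; _<_; _≤_; z≤n; s≤s)
  import Data.Nat.Properties as ℕP
  open import Data.Nat.ListAction using (sum)
  open import Data.Fin as Fin using (Fin; toℕ; fromℕ<)
  import Data.Fin.Properties as FinP
  open import Data.Fin.Permutation using (_⟨$⟩ˡ_; inverseʳ)
  open import Data.List as List using (List; []; _∷_; _++_; length; map; filter; concat; tabulate; allFin; lookup)
  import Data.List.Properties as ListP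
  open import Data.Vec as Vec using (Vec; toList; fromList; cast)
  import Data.Vec.Properties as VecP
  open import Data.List.Relation.Unary.All using (All; []; _∷_)
  import Data.List.Relation.Unary.All.Properties as AllP
  open import Data.List.Relation.Unary.AllPairs using ([]; _∷_)
  open import Data.List.Relation.Unary.Any using (here; there)
  open import Data.List.Relation.Unary.Unique.Propositional using (Unique)
  import Data.List.Relation.Unary.Unique.Propositional.Properties as UniqueP
  open import Data.List.Membership.Propositional using (_∈_; _∉_)
  open import Data.List.Membership.Propositional.Properties
  import Data.List.Membership.DecPropositional as DecMembership
  open import Data.List.Relation.Binary.Permutation.Propositional using (_↭_; ↭-refl; ↭-sym; ↭-trans; ↭-prep)
  import Data.List.Relation.Binary.Permutation.Propositional.Properties as PermP
  open import Data.Product using (∃; ∃₂; _×_; _,_; proj₁; proj₂)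
  open import Data.Sum using (_⊎_; inj₁; inj₂)
  open import Data.Unit using (⊤; tt)
  open import Relation.Nullary using (Dec; yes; no; contradiction)
  open import Relation.Binary.PropositionalEquality
  open import Algebra.Properties.Semiring.Sum ℕP.+-*-semiring using (sum-syntax; sum-cong-≗; ∑-distrib-+)

  Unique-++⁻ˡ : ∀ {A : Set} (xs : List A) {ys} → Unique (xs ++ ys) → Unique xs
  Unique-++⁻ˡ []       _           = []
  Unique-++⁻ˡ (x ∷ xs) (x∉ ∷ uniq) = AllP.++⁻ˡ xs x∉ ∷ Unique-++⁻ˡ xs uniq

  Unique-++⁻ʳ : ∀ {A : Set} (xs : List A) {ys} → Unique (xs ++ ys) → Unique ys
  Unique-++⁻ʳ []       uniq       = uniq
  Unique-++⁻ʳ (x ∷ xs) (_ ∷ uniq) = Unique-++⁻ʳ xs uniq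

  All≢⇒∉ : ∀ {A : Set} {x : A} {xs} → All (x ≢_) xs → x ∉ xs
  All≢⇒∉ x≢xs x∈xs = AllP.All¬⇒¬Any x≢xs x∈xs

  Unique-remove : ∀ {A : Set} (xs : List A) {x ys} → Unique (xs ++ x ∷ ys) → Unique (xs ++ ys) × x ∉ (xs ++ ys)
  Unique-remove []       (x∉ys ∷ uniq) = uniq , All≢⇒∉ x∉ys
  Unique-remove (z ∷ xs) {x} {ys} (z∉ ∷ uniq) with Unique-remove xs uniq
  ... | uniq′ , x∉ = drop xs z∉ ∷ uniq′ , x∉′
    where
    drop : ∀ xs → All (z ≢_) (xs ++ x ∷ ys) → All (z ≢_) (xs ++ ys)
    drop []       (_ ∷ z∉ys)   = z∉ys
    drop (w ∷ ws) (z≢w ∷ z∉)   = z≢w ∷ drop ws z∉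
    z≢x : ∀ xs → All (z ≢_) (xs ++ x ∷ ys) → z ≢ x
    z≢x []       (z≢x ∷ _) = z≢x
    z≢x (w ∷ ws) (_ ∷ z∉)  = z≢x ws z∉
    x∉′ : x ∉ (z ∷ xs ++ ys)
    x∉′ (here x≡z)  = z≢x xs z∉ (sym x≡z)
    x∉′ (there x∈) = x∉ x∈

  Unique-↭ : ∀ {A : Set} (xs ys : List A) → Unique xs → Unique ys →
             (∀ {z} → z ∈ xs → z ∈ ys) → (∀ {z} → z ∈ ys → z ∈ xs) → xs ↭ ys
  Unique-↭ []       []       _ _ _ _ = ↭-refl
  Unique-↭ []       (y ∷ ys) _ _ _ ys⊆ with ys⊆ (here refl)
  ... | ()
  Unique-↭ (x ∷ xs) ys (x∉xs ∷ uniq-xs) uniq-ys xs⊆ ys⊆ with ∈-∃++ (xs⊆ (here refl))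
  ... | us , vs , refl = ↭-trans (↭-prep x rest) (↭-sym (PermP.shift x us vs))
    where
    uniq-rest : Unique (us ++ vs) × x ∉ us ++ vs
    uniq-rest = Unique-remove us uniq-ys
    rest : xs ↭ (us ++ vs)
    rest = Unique-↭ xs (us ++ vs) uniq-xs (proj₁ uniq-rest) to from
      where
      to : ∀ {z} → z ∈ xs → z ∈ us ++ vs
      to {z} z∈xs with PermP.∈-resp-↭ (PermP.shift x us vs) (xs⊆ (there z∈xs))
      ... | here refl = contradiction z∈xs (All≢⇒∉ x∉xs)
      ... | there z∈  = z∈
      from : ∀ {z} → z ∈ us ++ vs → z ∈ xs
      from {z} z∈ with ys⊆ (PermP.∈-resp-↭ (↭-sym (PermP.shift x us vs)) (there z∈))
      ... | here refl = contradiction z∈ (proj₂ uniq-rest)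
      ... | there z∈xs = z∈xs

  module _ {A : Set} where

    ∈-concat-tabulate⁻ : ∀ {k} (g : Fin k → List A) {x} → x ∈ concat (tabulate g) → ∃ λ r → x ∈ g r
    ∈-concat-tabulate⁻ g x∈ with ∈-concat⁻′ (tabulate g) x∈
    ... | xs , x∈xs , xs∈ with ∈-tabulate⁻ xs∈
    ...   | r , refl = r , x∈xs

    ∈-concat-tabulate⁺ : ∀ {k} (g : Fin k → List A) {x} r → x ∈ g r → x ∈ concat (tabulate g)
    ∈-concat-tabulate⁺ g r x∈ = ∈-concat⁺′ x∈ (∈-tabulate⁺ r)

    Unique-concat-tabulate⁺ : ∀ {k} (g : Fin k → List A) → (∀ r → Unique (g r)) →
                              (∀ r r′ → r ≢ r′ → ∀ {x} → x ∈ g r → x ∉ g r′) → Unique (concat (tabulate g))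
    Unique-concat-tabulate⁺ {zero}  g uniq disjoint = []
    Unique-concat-tabulate⁺ {suc k} g uniq disjoint =
      UniqueP.++⁺ (uniq Fin.zero)
                  (Unique-concat-tabulate⁺ (λ r → g (Fin.suc r)) (λ r → uniq (Fin.suc r))
                                           (λ r r′ r≢r′ → disjoint (Fin.suc r) (Fin.suc r′) (λ p → r≢r′ (FinP.suc-injective p))))
                  (λ (x∈g₀ , x∈rest) → let (r , x∈gr) = ∈-concat-tabulate⁻ (λ r → g (Fin.suc r)) x∈rest
                                       in disjoint Fin.zero (Fin.suc r) (λ ()) x∈g₀ x∈gr)

    Unique-concat-tabulate⁻ : ∀ {k} (g : Fin k → List A) → Unique (concat (tabulate g)) → ∀ r → Unique (g r)
    Unique-concat-tabulate⁻ {suc k} g uniq Fin.zero    = Unique-++⁻ˡ (g Fin.zero) uniq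
    Unique-concat-tabulate⁻ {suc k} g uniq (Fin.suc r) = Unique-concat-tabulate⁻ (λ r → g (Fin.suc r)) (Unique-++⁻ʳ (g Fin.zero) uniq) r

    length-concat-tabulate : ∀ {k} (g : Fin k → List A) → length (concat (tabulate g)) ≡ ∑[ r < k ] length (g r)
    length-concat-tabulate {zero}  g = refl
    length-concat-tabulate {suc k} g = trans (ListP.length-++ (g Fin.zero)) (cong (length (g Fin.zero) +_) (length-concat-tabulate (λ r → g (Fin.suc r))))

    length-filter-tabulate : ∀ {k} {P : A → Set} (P? : ∀ x → Dec (P x)) (g : Fin k → A) →
                             length (filter P? (tabulate g)) ≡ ∑[ i < k ] 𝟙 (P? (g i))
    length-filter-tabulate {zero}  P? g = refl
    length-filter-tabulate {suc k} P? g with P? (g Fin.zero)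
    ... | yes _ = cong suc (length-filter-tabulate P? (λ i → g (Fin.suc i)))
    ... | no _  = length-filter-tabulate P? (λ i → g (Fin.suc i))

  assoc : ∀ {n} {X : Set} → X → Fin n → List (Fin n × X) → X
  assoc d i []             = d
  assoc d i ((j , x) ∷ xs) with i FinP.≟ j
  ... | yes _ = x
  ... | no _  = assoc d i xs

  assoc-∈ : ∀ {n} {X : Set} (d : X) (xs : List (Fin n × X)) → Unique (map proj₁ xs) → ∀ {i x} → (i , x) ∈ xs → assoc d i xs ≡ x
  assoc-∈ d ((j , x) ∷ xs) _ {i} (here refl) with i FinP.≟ i
  ... | yes _ = refl
  ... | no i≢i = contradiction refl i≢i
  assoc-∈ d ((j , x) ∷ xs) (j∉ ∷ uniq) {i} (there i,x∈) with i FinP.≟ j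
  ... | yes refl = contradiction (∈-map⁺ proj₁ i,x∈) (All≢⇒∉ j∉)
  ... | no _     = assoc-∈ d xs uniq i,x∈

  ∈-assoc : ∀ {n} {X : Set} (d : X) (xs : List (Fin n × X)) {i} → i ∈ map proj₁ xs → (i , assoc d i xs) ∈ xs
  ∈-assoc d ((j , x) ∷ xs) {i} i∈ with i FinP.≟ j
  ... | yes refl = here refl
  ∈-assoc d ((j , x) ∷ xs) {i} (here i≡j)  | no i≢j = contradiction i≡j i≢j
  ∈-assoc d ((j , x) ∷ xs) {i} (there i∈) | no _   = there (∈-assoc d xs i∈)

  _∈?_ : ∀ {n} (i : Fin n) (xs : List (Fin n)) → Dec (i ∈ xs)
  _∈?_ {n} = DecMembership._∈?_ (FinP._≟_ {n})

  ∑-𝟙-≟ : ∀ {n} (x : Fin n) → ∑[ i < n ] 𝟙 (i FinP.≟ x) ≡ 1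
  ∑-𝟙-≟ {suc n} Fin.zero    = cong suc (∑-zero (λ (i : Fin n) → 𝟙 (Fin.suc i FinP.≟ Fin.zero)) (λ _ → refl))
  ∑-𝟙-≟ {suc n} (Fin.suc x) = trans (cong₂ _+_ (𝟙-no (λ ()) (Fin.zero FinP.≟ Fin.suc x))
                                          (sum-cong-≗ (λ i → 𝟙-cong FinP.suc-injective (cong Fin.suc) (Fin.suc i FinP.≟ Fin.suc x) (i FinP.≟ x))))
                                (∑-𝟙-≟ x)

  ∑-𝟙-∈ : ∀ {n} (xs : List (Fin n)) → Unique xs → ∑[ i < n ] 𝟙 (i ∈? xs) ≡ length xs
  ∑-𝟙-∈ {n} []       _           = ∑-zero (λ (i : Fin n) → 𝟙 (i ∈? [])) (λ _ → refl)
  ∑-𝟙-∈ {n} (x ∷ xs) (x∉ ∷ uniq) =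
    trans (sum-cong-≗ split) (trans (∑-distrib-+ (λ (i : Fin n) → 𝟙 (i FinP.≟ x)) (λ i → 𝟙 (i ∈? xs))) (cong₂ _+_ (∑-𝟙-≟ x) (∑-𝟙-∈ xs uniq)))
    where
    split : ∀ (i : Fin n) → 𝟙 (i ∈? (x ∷ xs)) ≡ 𝟙 (i FinP.≟ x) + 𝟙 (i ∈? xs)
    split i with i FinP.≟ x | i ∈? xs
    ... | yes refl | yes i∈xs = contradiction i∈xs (All≢⇒∉ x∉)
    ... | yes refl | no _     = refl
    ... | no i≢x   | yes i∈xs = refl
    ... | no i≢x   | no i∉xs  = refl

  ∑≤1≡n⇒≡1 : ∀ {n} (f : Fin n → ℕ) → (∀ i → f i ≤ 1) → ∑[ i < n ] f i ≡ n → ∀ i → f i ≡ 1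
  ∑≤1≡n⇒≡1 {suc n} f f≤1 ∑f≡n i with f Fin.zero in f₀ | f≤1 Fin.zero
  ... | zero  | _ = contradiction (ℕP.≤-trans (ℕP.≤-reflexive (sym ∑f≡n)) (∑≤ (λ i → f (Fin.suc i)) (λ i → f≤1 (Fin.suc i)))) (ℕP.n≮n n)
    where
    ∑≤ : ∀ {k} (g : Fin k → ℕ) → (∀ i → g i ≤ 1) → ∑[ i < k ] g i ≤ k
    ∑≤ {zero}  g _   = z≤n
    ∑≤ {suc k} g g≤1 = ℕP.+-mono-≤ (g≤1 Fin.zero) (∑≤ (λ i → g (Fin.suc i)) (λ i → g≤1 (Fin.suc i)))
  ... | suc zero | _ with i
  ...   | Fin.zero    = f₀
  ...   | Fin.suc i′  = ∑≤1≡n⇒≡1 (λ i → f (Fin.suc i)) (λ i → f≤1 (Fin.suc i)) (ℕP.suc-injective ∑f≡n) i′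
  ∑≤1≡n⇒≡1 {suc n} f f≤1 ∑f≡n i | suc (suc _) | s≤s ()

  Unique∧length≡n⇒∈ : ∀ {n} (xs : List (Fin n)) → Unique xs → length xs ≡ n → ∀ i → i ∈ xs
  Unique∧length≡n⇒∈ {n} xs uniq |xs|≡n i with i ∈? xs | ∑≤1≡n⇒≡1 (λ (j : Fin n) → 𝟙 (j ∈? xs)) (λ j → 𝟙≤1 (j ∈? xs)) (trans (∑-𝟙-∈ xs uniq) |xs|≡n) i
  ... | yes i∈xs | _ = i∈xs
  ... | no _     | ()

  toList-cast : ∀ {A : Set} {k l} .(eq : k ≡ l) (xs : Vec A k) → toList (Vec.cast eq xs) ≡ toList xs
  toList-cast {l = zero}  eq Vec.[]         = refl
  toList-cast {l = suc l} eq (x Vec.∷ xs) = cong (x ∷_) (toList-cast (cong ℕ.pred eq) xs)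

  module Tabloids {m n : ℕ} (_⊕_ : Fin m → Fin m → Fin m) where
    open Configurations {m} {n} _⊕_

    module Diagram {L : Set} (s : Side) (ι : ℕ → L → Cell m) (ι-row : ∀ r c → rowOf (ι r c) ≡ (s , r))
                   (ι-injective : ∀ {r r′ c c′} → ι r c ≡ ι r′ c′ → r ≡ r′ × c ≡ c′) (sh : List ℕ) where

      place : Fin (length sh) → L × Fin n → Fin n × Cell m
      place r (c , i) = i , ι (toℕ r) c

      placements : Tableau L n sh → List (Fin n × Cell m)
      placements t = concat (tabulate (λ r → map (place r) (toList (row t r))))

      keys-placements : ∀ (t : Tableau L n sh) → map proj₁ (placements t) ≡ indices t
      keys-placements t = begin
        map proj₁ (concat (tabulate rows))
          ≡⟨ ListP.concat-map (tabulate rows) ⟨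
        concat (map (map proj₁) (tabulate rows))
          ≡⟨ cong concat (ListP.map-tabulate rows (map proj₁)) ⟩
        concat (tabulate (λ r → map proj₁ (rows r)))
          ≡⟨ cong concat (ListP.tabulate-cong (λ r → ListP.map-∘ (toList (row t r)))) ⟨
        indices t ∎
        where
        open ≡-Reasoning
        rows : Fin (length sh) → List (Fin n × Cell m)
        rows r = map (place r) (toList (row t r))

      ∈-placements⁻ : ∀ (t : Tableau L n sh) {i e} → (i , e) ∈ placements t → ∃₂ λ r c → e ≡ ι (toℕ r) c × (c , i) ∈ toList (row t r)
      ∈-placements⁻ t i,e∈ with ∈-concat-tabulate⁻ (λ r → map (place r) (toList (row t r))) i,e∈
      ... | r , i,e∈r with ∈-map⁻ (place r) i,e∈r
      ...   | (c , _) , c,i∈ , refl = r , c , refl , c,i∈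

      ∈-placements⁺ : ∀ (t : Tableau L n sh) r {c i} → (c , i) ∈ toList (row t r) → (i , ι (toℕ r) c) ∈ placements t
      ∈-placements⁺ t r c,i∈ = ∈-concat-tabulate⁺ (λ r → map (place r) (toList (row t r))) r (∈-map⁺ (place r) c,i∈)

      length-indices : ∀ (t : Tableau L n sh) → length (indices t) ≡ size sh
      length-indices t = begin
        length (indices t)
          ≡⟨ length-concat-tabulate (λ r → map proj₂ (toList (row t r))) ⟩
        ∑[ r < length sh ] length (map proj₂ (toList (row t r)))
          ≡⟨ sum-cong-≗ (λ r → trans (ListP.length-map proj₂ (toList (row t r))) (VecP.length-toList (row t r))) ⟩
        ∑[ r < length sh ] lookup sh r
          ≡⟨ ∑-lookup sh ⟩
        size sh ∎
        where
        open ≡-Reasoning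
        ∑-lookup : ∀ sh → ∑[ r < length sh ] lookup sh r ≡ sum sh
        ∑-lookup []       = refl
        ∑-lookup (x ∷ sh) = cong (x +_) (∑-lookup sh)

      rows-unique : ∀ (t : Tableau L n sh) → Unique (indices t) → ∀ r → Unique (toList (row t r))
      rows-unique t uniq r = UniqueP.map⁻ (Unique-concat-tabulate⁻ (λ r → map proj₂ (toList (row t r))) uniq r)

      ∼row⇒⊆ : ∀ {t t′ : Tableau L n sh} → t ∼row t′ → ∀ {i e} → (i , e) ∈ placements t → (i , e) ∈ placements t′
      ∼row⇒⊆ {t} {t′} t∼t′ i,e∈ with ∈-placements⁻ t i,e∈
      ... | r , c , refl , c,i∈ = ∈-placements⁺ t′ r (PermP.∈-resp-↭ (t∼t′ r) c,i∈)

      ⊆⇒∼row : ∀ {t t′ : Tableau L n sh} → Unique (indices t) → Unique (indices t′) →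
               (∀ {i e} → (i , e) ∈ placements t → (i , e) ∈ placements t′) →
               (∀ {i e} → (i , e) ∈ placements t′ → (i , e) ∈ placements t) → t ∼row t′
      ⊆⇒∼row {t} {t′} uniq uniq′ t⊆t′ t′⊆t r =
        Unique-↭ _ _ (rows-unique t uniq r) (rows-unique t′ uniq′ r) (same-row t t′ t⊆t′) (same-row t′ t t′⊆t)
        where
        same-row : ∀ s s′ → (∀ {i e} → (i , e) ∈ placements s → (i , e) ∈ placements s′) →
                   ∀ {z} → z ∈ toList (row s r) → z ∈ toList (row s′ r)
        same-row s s′ s⊆s′ {c , i} c,i∈ with ∈-placements⁻ s′ (s⊆s′ (∈-placements⁺ s r c,i∈))
        ... | r′ , c′ , ιrc≡ , c′,i∈ with ι-injective ιrc≡
        ...   | r≡r′ , refl = subst (λ r″ → (c , i) ∈ toList (row s′ r″)) (sym (FinP.toℕ-injective r≡r′)) c′,i∈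

      act : (Fin n → Fin n) → (Fin n → L → L) → Tableau L n sh → Tableau L n sh
      act p α t = tab (λ r → Vec.map (λ (c , i) → α (p i) c , p i) (row t r))

      indices-act : ∀ p α (t : Tableau L n sh) → indices (act p α t) ≡ map p (indices t)
      indices-act p α t = begin
        concat (tabulate (λ r → map proj₂ (toList (Vec.map φ (row t r)))))
          ≡⟨ cong concat (ListP.tabulate-cong row-indices) ⟩
        concat (tabulate (λ r → map p (map proj₂ (toList (row t r)))))
          ≡⟨ cong concat (ListP.map-tabulate (λ r → map proj₂ (toList (row t r))) (map p)) ⟨
        concat (map (map p) (tabulate (λ r → map proj₂ (toList (row t r)))))
          ≡⟨ ListP.concat-map (tabulate (λ r → map proj₂ (toList (row t r)))) ⟩
        map p (indices t) ∎
        where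
        open ≡-Reasoning
        φ : L × Fin n → L × Fin n
        φ (c , i) = α (p i) c , p i
        row-indices : ∀ r → map proj₂ (toList (Vec.map φ (row t r))) ≡ map p (map proj₂ (toList (row t r)))
        row-indices r = trans (cong (map proj₂) (VecP.toList-map φ (row t r)))
                              (trans (sym (ListP.map-∘ (toList (row t r)))) (ListP.map-∘ (toList (row t r))))

      ∈-placements-act : ∀ p α (upd : Fin n → Cell m → Cell m) → (∀ q r c → ι r (α q c) ≡ upd q (ι r c)) →
                         ∀ (t : Tableau L n sh) {i e} → (i , e) ∈ placements t → (p i , upd (p i) e) ∈ placements (act p α t)
      ∈-placements-act p α upd ι-α t i,e∈ with ∈-placements⁻ t i,e∈
      ... | r , c , refl , c,i∈ =
        subst (λ e → (_ , e) ∈ placements (act p α t)) (ι-α _ (toℕ r) c)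
              (∈-placements⁺ (act p α t) r (subst (_ ∈_) (sym (VecP.toList-map _ (row t r))) (∈-map⁺ _ c,i∈)))

      placement-side : ∀ (t : Tableau L n sh) {i e} → (i , e) ∈ placements t → proj₁ (rowOf e) ≡ s
      placement-side t i,e∈ with ∈-placements⁻ t i,e∈
      ... | r , c , refl , _ = cong proj₁ (ι-row (toℕ r) c)

      rowCount≡nth : ∀ (t : Tableau L n sh) → Unique (indices t) → (f : Config) →
                     (∀ i {r} → rowOf (f i) ≡ (s , r) → ∃₂ λ r′ c → toℕ r′ ≡ r × (c , i) ∈ toList (row t r′)) →
                     (∀ r {c i} → (c , i) ∈ toList (row t r) → rowOf (f i) ≡ (s , toℕ r)) →
                     ∀ r → rowCount f (s , r) ≡ nth sh r
      rowCount≡nth t uniq f row⁻ row⁺ r with ℕP.<-≤-connex r (length sh)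
      ... | inj₁ r<len = begin
        rowCount f (s , r)                     ≡⟨ sum-cong-≗ (λ i → 𝟙-cong (to i) (from i) (rowOf (f i) ≟ᴿ (s , r)) (i ∈? members)) ⟩
        ∑[ i < n ] 𝟙 (i ∈? members)            ≡⟨ ∑-𝟙-∈ members (Unique-concat-tabulate⁻ (λ r → map proj₂ (toList (row t r))) uniq r′) ⟩
        length members                         ≡⟨ trans (ListP.length-map proj₂ (toList (row t r′))) (VecP.length-toList (row t r′)) ⟩
        lookup sh r′                           ≡⟨ nth-lookup sh r′ ⟨
        nth sh (toℕ r′)                        ≡⟨ cong (nth sh) (FinP.toℕ-fromℕ< r<len) ⟩
        nth sh r                               ∎
        where
        open ≡-Reasoning
        r′ : Fin (length sh)
        r′ = fromℕ< r<len
        members : List (Fin n)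
        members = map proj₂ (toList (row t r′))
        to : ∀ i → rowOf (f i) ≡ (s , r) → i ∈ members
        to i i∈r with row⁻ i i∈r
        ... | r″ , c , r″≡r , c,i∈ =
          ∈-map⁺ proj₂ (subst (λ q → (c , i) ∈ toList (row t q)) (FinP.toℕ-injective (trans r″≡r (sym (FinP.toℕ-fromℕ< r<len)))) c,i∈)
        from : ∀ i → i ∈ members → rowOf (f i) ≡ (s , r)
        from i i∈ with ∈-map⁻ proj₂ i∈
        ... | (c , _) , c,i∈ , refl = trans (row⁺ r′ c,i∈) (cong (s ,_) (FinP.toℕ-fromℕ< r<len))
      ... | inj₂ len≤r = trans (∑-zero _ (λ i → 𝟙-no (beyond i) (rowOf (f i) ≟ᴿ (s , r)))) (sym (nth-beyond sh len≤r))
        where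
        beyond : ∀ i → rowOf (f i) ≢ (s , r)
        beyond i i∈r with row⁻ i i∈r
        ... | r″ , _ , r″≡r , _ = ℕP.<⇒≱ (subst (_< length sh) r″≡r (FinP.toℕ<n r″)) len≤r

      module Decode (f : Config) (lab : Fin n → L) (count : ∀ r → rowCount f (s , r) ≡ nth sh r) where

        members : ℕ → List (Fin n)
        members r = filter (λ i → rowOf (f i) ≟ᴿ (s , r)) (allFin n)

        entries : Fin (length sh) → List (L × Fin n)
        entries r = map (λ i → lab i , i) (members (toℕ r))

        length-entries : ∀ r → length (entries r) ≡ lookup sh r
        length-entries r = trans (ListP.length-map _ (members (toℕ r)))
                                 (trans (length-filter-tabulate (λ i → rowOf (f i) ≟ᴿ (s , toℕ r)) (λ i → i))
                                        (trans (count (toℕ r)) (nth-lookup sh r)))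

        decoded : Tableau L n sh
        decoded = tab (λ r → Vec.cast (length-entries r) (fromList (entries r)))

        row-decoded : ∀ r → toList (row decoded r) ≡ entries r
        row-decoded r = trans (toList-cast (length-entries r) (fromList (entries r))) (VecP.toList∘fromList (entries r))

        ∈-decoded⁺ : ∀ r {i} → rowOf (f i) ≡ (s , toℕ r) → (lab i , i) ∈ toList (row decoded r)
        ∈-decoded⁺ r {i} i∈r = subst ((lab i , i) ∈_) (sym (row-decoded r))
                                     (∈-map⁺ (λ i → lab i , i) (∈-filter⁺ (λ i → rowOf (f i) ≟ᴿ (s , toℕ r)) (∈-allFin i) i∈r))

        indices-decoded : indices decoded ≡ concat (tabulate (λ (r : Fin (length sh)) → members (toℕ r)))
        indices-decoded = cong concat (ListP.tabulate-cong (λ r →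
          trans (cong (map proj₂) (row-decoded r)) (trans (sym (ListP.map-∘ (members (toℕ r)))) (ListP.map-id (members (toℕ r))))))

        ∈-indices⁻ : ∀ {i} → i ∈ indices decoded → ∃ λ r → rowOf (f i) ≡ (s , toℕ r)
        ∈-indices⁻ i∈ with ∈-concat-tabulate⁻ (λ (r : Fin (length sh)) → members (toℕ r)) (subst (_ ∈_) indices-decoded i∈)
        ... | r , i∈r = r , proj₂ (∈-filter⁻ (λ i → rowOf (f i) ≟ᴿ (s , toℕ r)) {xs = allFin n} i∈r)

        unique : Unique (indices decoded)
        unique = subst Unique (sym indices-decoded)
          (Unique-concat-tabulate⁺ (λ (r : Fin (length sh)) → members (toℕ r)) (λ r → UniqueP.filter⁺ _ (UniqueP.allFin⁺ n))
            (λ r r′ r≢r′ i∈r i∈r′ → r≢r′ (FinP.toℕ-injective (cong proj₂ (trans (sym (row-of r i∈r)) (row-of r′ i∈r′))))))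
          where
          row-of : ∀ r {i} → i ∈ members (toℕ r) → rowOf (f i) ≡ (s , toℕ r)
          row-of r i∈r = proj₂ (∈-filter⁻ (λ i → rowOf (f i) ≟ᴿ (s , toℕ r)) {xs = allFin n} i∈r)

        placed : ∀ i {r} → rowOf (f i) ≡ (s , r) → (i , ι r (lab i)) ∈ placements decoded
        placed i {r} i∈r = subst (λ r′ → (i , ι r′ (lab i)) ∈ placements decoded) (FinP.toℕ-fromℕ< r<len)
                                 (∈-placements⁺ decoded (fromℕ< r<len) (∈-decoded⁺ (fromℕ< r<len) (trans i∈r (cong (s ,_) (sym (FinP.toℕ-fromℕ< r<len))))))
          where
          r<len : r < length sh
          r<len = nth>0⇒< sh (ℕP.<-≤-trans (ℕP.≤-trans (s≤s z≤n) (ℕP.≤-reflexive (sym (𝟙-yes i∈r (rowOf (f i) ≟ᴿ (s , r))))))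
                                           (ℕP.≤-trans (∑-≤ (λ j → 𝟙 (rowOf (f j) ≟ᴿ (s , r))) i) (ℕP.≤-reflexive (count r))))

    σ-cell-injective : ∀ {r r′} {c c′ : Fin m} → _≡_ {A = Cell m} (σ-cell r c) (σ-cell r′ c′) → r ≡ r′ × c ≡ c′
    σ-cell-injective refl = refl , refl

    ρ-cell-injective : ∀ {r r′} {c c′ : ⊤} → _≡_ {A = Cell m} (ρ-cell r) (ρ-cell r′) → r ≡ r′ × c ≡ c′
    ρ-cell-injective refl = refl , refl

    module DoubleTabloid (σ ρ : List ℕ) (n≡ : size σ + size ρ ≡ n) where

      module Dσ = Diagram σ-side (λ r c → σ-cell r c) (λ _ _ → refl) σ-cell-injective σ
      module Dρ = Diagram ρ-side (λ r (_ : ⊤) → ρ-cell r) (λ _ _ → refl) ρ-cell-injective ρ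

      shape : Row → ℕ
      shape = shapeOf (nth σ) (nth ρ)

      placements : DTableau m n σ ρ → List (Fin n × Cell m)
      placements (a , b) = Dσ.placements a ++ Dρ.placements b

      -- The junk default ρ-cell 0 is never returned on a valid tableau.
      enc : DTableau m n σ ρ → Config
      enc T i = assoc (ρ-cell 0) i (placements T)

      module _ {a : Tableau (Fin m) n σ} {b : Tableau ⊤ n ρ} (valid : ValidDT (a , b)) where

        private
          keys : map proj₁ (placements (a , b)) ≡ indices a ++ indices b
          keys = trans (ListP.map-++ proj₁ (Dσ.placements a) (Dρ.placements b)) (cong₂ _++_ (Dσ.keys-placements a) (Dρ.keys-placements b))

        ∈-enc : ∀ {i e} → (i , e) ∈ placements (a , b) → enc (a , b) i ≡ e
        ∈-enc = assoc-∈ (ρ-cell 0) (placements (a , b)) (subst Unique (sym keys) valid)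

        enc-∈ : ∀ i → (i , enc (a , b) i) ∈ placements (a , b)
        enc-∈ i = ∈-assoc (ρ-cell 0) (placements (a , b)) (subst (i ∈_) (sym keys) (Unique∧length≡n⇒∈ _ valid length≡n i))
          where
          length≡n : length (indices a ++ indices b) ≡ n
          length≡n = trans (ListP.length-++ (indices a)) (trans (cong₂ _+_ (Dσ.length-indices a) (Dρ.length-indices b)) n≡)

        enc-placement : ∀ i → (∃₂ λ r c → enc (a , b) i ≡ σ-cell (toℕ r) c × (c , i) ∈ toList (row a r))
                            ⊎ (∃₂ λ r c → enc (a , b) i ≡ ρ-cell (toℕ r) × (c , i) ∈ toList (row b r))
        enc-placement i with ∈-++⁻ (Dσ.placements a) (enc-∈ i)
        ... | inj₁ i∈a = inj₁ (Dσ.∈-placements⁻ a i∈a)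
        ... | inj₂ i∈b = inj₂ (Dρ.∈-placements⁻ b i∈b)

        enc-shape : HasShape shape (enc (a , b))
        enc-shape (σ-side , r) = Dσ.rowCount≡nth a (Unique-++⁻ˡ (indices a) valid) (enc (a , b)) row⁻ row⁺ r
          where
          row⁻ : ∀ i {r} → rowOf (enc (a , b) i) ≡ (σ-side , r) → _
          row⁻ i i∈r with enc-placement i
          ... | inj₁ (r′ , c , enc≡ , c,i∈) = r′ , c , cong proj₂ (trans (sym (cong rowOf enc≡)) i∈r) , c,i∈
          ... | inj₂ (r′ , c , enc≡ , _) with trans (sym (cong rowOf enc≡)) i∈r
          ...   | ()
          row⁺ : ∀ r {c i} → (c , i) ∈ toList (row a r) → rowOf (enc (a , b) i) ≡ (σ-side , toℕ r)
          row⁺ r c,i∈ = cong rowOf (∈-enc (∈-++⁺ˡ (Dσ.∈-placements⁺ a r c,i∈)))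
        enc-shape (ρ-side , r) = Dρ.rowCount≡nth b (Unique-++⁻ʳ (indices a) valid) (enc (a , b)) row⁻ row⁺ r
          where
          row⁻ : ∀ i {r} → rowOf (enc (a , b) i) ≡ (ρ-side , r) → _
          row⁻ i i∈r with enc-placement i
          ... | inj₂ (r′ , c , enc≡ , c,i∈) = r′ , c , cong proj₂ (trans (sym (cong rowOf enc≡)) i∈r) , c,i∈
          ... | inj₁ (r′ , c , enc≡ , _) with trans (sym (cong rowOf enc≡)) i∈r
          ...   | ()
          row⁺ : ∀ r {c i} → (c , i) ∈ toList (row b r) → rowOf (enc (a , b) i) ≡ (ρ-side , toℕ r)
          row⁺ r c,i∈ = cong rowOf (∈-enc (∈-++⁺ʳ (Dσ.placements a) (Dρ.∈-placements⁺ b r c,i∈)))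

      act-placements : ∀ y (T : DTableau m n σ ρ) {i e} → (i , e) ∈ placements T →
                       (y · i , shift (vec y (y · i)) e) ∈ placements (actDT _⊕_ y T)
      act-placements y (a , b) i,e∈ with ∈-++⁻ (Dσ.placements a) i,e∈
      ... | inj₁ i,e∈a = ∈-++⁺ˡ (Dσ.∈-placements-act (y ·_) (λ q c → c ⊕ vec y q) (λ q → shift (vec y q)) (λ _ _ _ → refl) a i,e∈a)
      ... | inj₂ i,e∈b = ∈-++⁺ʳ _ (Dρ.∈-placements-act (y ·_) (λ _ c → c) (λ q → shift (vec y q)) (λ _ _ _ → refl) b i,e∈b)

      act-valid : ∀ y {a b} → ValidDT (a , b) → ValidDT (actDT _⊕_ y (a , b))
      act-valid y {a} {b} valid = subst Unique (sym indices≡) (UniqueP.map⁺ (·-injective y) valid)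
        where
        indices≡ : indices (proj₁ (actDT _⊕_ y (a , b))) ++ indices (proj₂ (actDT _⊕_ y (a , b))) ≡ map (y ·_) (indices a ++ indices b)
        indices≡ = trans (cong₂ _++_ (Dσ.indices-act (y ·_) (λ q c → c ⊕ vec y q) a) (Dρ.indices-act (y ·_) (λ _ c → c) b)) (sym (ListP.map-++ (y ·_) (indices a) (indices b)))

      enc-act : ∀ y {a b} (valid : ValidDT (a , b)) i → enc (actDT _⊕_ y (a , b)) (y · i) ≡ shift (vec y (y · i)) (enc (a , b) i)
      enc-act y valid i = ∈-enc (act-valid y valid) (act-placements y _ (enc-∈ valid i))

      ∼DT⇒enc≗ : ∀ {a b a′ b′} → ValidDT (a , b) → ValidDT (a′ , b′) → (a , b) ∼DT (a′ , b′) → ∀ i → enc (a , b) i ≡ enc (a′ , b′) i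
      ∼DT⇒enc≗ {a} {b} {a′} {b′} valid valid′ (a∼a′ , b∼b′) i = sym (∈-enc valid′ (carry (enc-∈ valid i)))
        where
        carry : ∀ {i e} → (i , e) ∈ placements (a , b) → (i , e) ∈ placements (a′ , b′)
        carry i,e∈ with ∈-++⁻ (Dσ.placements a) i,e∈
        ... | inj₁ i,e∈a = ∈-++⁺ˡ (Dσ.∼row⇒⊆ a∼a′ i,e∈a)
        ... | inj₂ i,e∈b = ∈-++⁺ʳ _ (Dρ.∼row⇒⊆ b∼b′ i,e∈b)

      enc≗⇒∼DT : ∀ {a b a′ b′} → ValidDT (a , b) → ValidDT (a′ , b′) → (∀ i → enc (a , b) i ≡ enc (a′ , b′) i) → (a , b) ∼DT (a′ , b′)
      enc≗⇒∼DT {a} {b} {a′} {b′} valid valid′ enc≗ =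
          Dσ.⊆⇒∼row (Unique-++⁻ˡ (indices a) valid) (Unique-++⁻ˡ (indices a′) valid′)
                    (σ-part valid valid′ enc≗) (σ-part valid′ valid (λ i → sym (enc≗ i)))
        , Dρ.⊆⇒∼row (Unique-++⁻ʳ (indices a) valid) (Unique-++⁻ʳ (indices a′) valid′)
                    (ρ-part valid valid′ enc≗) (ρ-part valid′ valid (λ i → sym (enc≗ i)))
        where
        carry : ∀ {a b a′ b′} → ValidDT (a , b) → ValidDT (a′ , b′) → (∀ i → enc (a , b) i ≡ enc (a′ , b′) i) →
                ∀ {i e} → (i , e) ∈ placements (a , b) → (i , e) ∈ placements (a′ , b′)
        carry valid valid′ enc≗ {i} i,e∈ = subst (λ e → (i , e) ∈ placements _) (trans (sym (enc≗ i)) (∈-enc valid i,e∈)) (enc-∈ valid′ i)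
        σ-part : ∀ {a b a′ b′} → ValidDT (a , b) → ValidDT (a′ , b′) → (∀ i → enc (a , b) i ≡ enc (a′ , b′) i) →
                 ∀ {i e} → (i , e) ∈ Dσ.placements a → (i , e) ∈ Dσ.placements a′
        σ-part {a} {b} {a′} {b′} valid valid′ enc≗ i,e∈ with ∈-++⁻ (Dσ.placements a′) (carry valid valid′ enc≗ (∈-++⁺ˡ i,e∈))
        ... | inj₁ i,e∈a′ = i,e∈a′
        ... | inj₂ i,e∈b′ with trans (sym (Dσ.placement-side a i,e∈)) (Dρ.placement-side b′ i,e∈b′)
        ...   | ()
        ρ-part : ∀ {a b a′ b′} → ValidDT (a , b) → ValidDT (a′ , b′) → (∀ i → enc (a , b) i ≡ enc (a′ , b′) i) →
                 ∀ {i e} → (i , e) ∈ Dρ.placements b → (i , e) ∈ Dρ.placements b′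
        ρ-part {a} {b} {a′} {b′} valid valid′ enc≗ i,e∈ with ∈-++⁻ (Dσ.placements a′) (carry valid valid′ enc≗ (∈-++⁺ʳ (Dσ.placements a) i,e∈))
        ... | inj₂ i,e∈b′ = i,e∈b′
        ... | inj₁ i,e∈a′ with trans (sym (Dρ.placement-side b i,e∈)) (Dσ.placement-side a′ i,e∈a′)
        ...   | ()

      act∼⇒Maps : ∀ y {a b a′ b′} → ValidDT (a , b) → ValidDT (a′ , b′) → actDT _⊕_ y (a , b) ∼DT (a′ , b′) → Maps y (enc (a , b)) (enc (a′ , b′))
      act∼⇒Maps y valid valid′ y·T∼T′ i = trans (sym (∼DT⇒enc≗ (act-valid y valid) valid′ y·T∼T′ (y · i))) (enc-act y valid i)

      Maps⇒act∼ : ∀ y {a b a′ b′} → ValidDT (a , b) → ValidDT (a′ , b′) → Maps y (enc (a , b)) (enc (a′ , b′)) → actDT _⊕_ y (a , b) ∼DT (a′ , b′)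
      Maps⇒act∼ y valid valid′ maps = enc≗⇒∼DT (act-valid y valid) valid′ enc≗
        where
        enc≗ : ∀ q → enc (actDT _⊕_ y _) q ≡ enc _ q
        enc≗ q = subst (λ q → enc (actDT _⊕_ y _) q ≡ enc _ q) (inverseʳ (perm y))
                       (trans (enc-act y valid (perm y ⟨$⟩ˡ q)) (sym (maps (perm y ⟨$⟩ˡ q))))

      -- e₀ only fills the labels of entries that the σ-diagram never shows.
      module Decode (e₀ : Fin m) (f : Config) (f-shape : HasShape shape f) where

        label : Fin n → Fin m
        label i with f i
        ... | σ-cell _ c = c
        ... | ρ-cell _   = e₀

        module Fσ = Dσ.Decode f label (λ r → f-shape (σ-side , r))
        module Fρ = Dρ.Decode f (λ _ → tt) (λ r → f-shape (ρ-side , r))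

        decoded : DTableau m n σ ρ
        decoded = Fσ.decoded , Fρ.decoded

        decoded-valid : ValidDT decoded
        decoded-valid = UniqueP.++⁺ Fσ.unique Fρ.unique λ (i∈a , i∈b) →
          side-clash (proj₂ (Fσ.∈-indices⁻ i∈a)) (proj₂ (Fρ.∈-indices⁻ i∈b))
          where
          side-clash : ∀ {i r r′} → rowOf (f i) ≡ (σ-side , r) → rowOf (f i) ≢ (ρ-side , r′)
          side-clash i∈σ i∈ρ with trans (sym i∈σ) i∈ρ
          ... | ()

        label-σ : ∀ i {r c} → f i ≡ σ-cell r c → label i ≡ c
        label-σ i fi≡ rewrite fi≡ = refl

        placed : ∀ i → (i , f i) ∈ placements decoded
        placed i with f i in fi≡
        ... | σ-cell r c = ∈-++⁺ˡ (subst (λ c → (i , σ-cell r c) ∈ Dσ.placements Fσ.decoded) (label-σ i fi≡) (Fσ.placed i (cong rowOf fi≡)))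
        ... | ρ-cell r   = ∈-++⁺ʳ (Dσ.placements Fσ.decoded) (Fρ.placed i (cong rowOf fi≡))

        enc-decoded : ∀ i → enc decoded i ≡ f i
        enc-decoded i = ∈-enc decoded-valid (placed i)

      Transitive⇒ConfigTransitive : Fin m → ∀ Y → Transitive _⊕_ σ ρ Y → ConfigTransitive shape Y
      Transitive⇒ConfigTransitive e₀ Y (_ , c , c>0 , counts) = c , c>0 , λ f h f∶shape h∶shape →
        let module F = Decode e₀ f f∶shape
            module H = Decode e₀ h h∶shape
        in CountIs-cong (λ y y·F∼H → Maps-cong {y} F.enc-decoded H.enc-decoded (act∼⇒Maps y F.decoded-valid H.decoded-valid y·F∼H))
                        (λ y maps → Maps⇒act∼ y F.decoded-valid H.decoded-valid
                                      (Maps-cong {y} (λ i → sym (F.enc-decoded i)) (λ i → sym (H.enc-decoded i)) maps))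
                        (counts F.decoded H.decoded F.decoded-valid H.decoded-valid)

      ConfigTransitive⇒Transitive : ∀ Y → Y ≢ [] → ConfigTransitive shape Y → Transitive _⊕_ σ ρ Y
      ConfigTransitive⇒Transitive Y Y≢[] (c , c>0 , counts) = Y≢[] , c , c>0 , λ (a , b) (a′ , b′) valid valid′ →
        CountIs-cong (λ y → Maps⇒act∼ y valid valid′) (λ y → act∼⇒Maps y valid valid′)
                     (counts (enc (a , b)) (enc (a′ , b′)) (enc-shape valid) (enc-shape valid′))

open Dominance
open BoxMoves
open TabloidEncoding
import Data.Nat as ℕ
import Data.Nat.Properties as ℕP
open import Data.Product using (_,_)
open import Relation.Binary.PropositionalEquality using (_≢_; refl; sym; trans; cong; subst₂)

move-fewer : ∀ ν {i j} → i < j → ν j ℕ.≤ ν i → move ν i j j < move ν i j i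
move-fewer ν {i} {j} i<j νj≤νi =
  subst₂ _<_ (sym (move-at-j ν (ℕP.<⇒≢ i<j))) (sym (move-at-i ν i j)) (ℕ.s≤s (ℕP.≤-trans ℕP.pred[n]≤n νj≤νi))

move-loss : ∀ ν {i j} → i < j → 0 < ν j → ν j ≡ ℕ.suc (move ν i j j)
move-loss ν i<j νj>0 = sym (trans (cong ℕ.suc (move-at-j ν (ℕP.<⇒≢ i<j))) (ℕP.suc-pred _ {{ℕ.>-nonZero νj>0}}))

moveBox-σ : ∀ ν ν′ {i j} → i < j → 0 < ν j → BoxMove (shapeOf ν ν′) (shapeOf (move ν i j) ν′)
moveBox-σ ν ν′ {i} {j} i<j νj>0 = record
  { side = σ-side ; to = i ; from = j ; to≢from = ℕP.<⇒≢ i<j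
  ; gain = move-at-i ν i j ; loss = move-loss ν i<j νj>0 ; rest = rest }
  where
  rest : ∀ k → k ≢ (σ-side , i) → k ≢ (σ-side , j) → shapeOf (move ν i j) ν′ k ≡ shapeOf ν ν′ k
  rest (σ-side , r) r≢i r≢j = move-elsewhere ν (λ r≡i → r≢i (cong (σ-side ,_) r≡i)) (λ r≡j → r≢j (cong (σ-side ,_) r≡j))
  rest (ρ-side , r) _   _   = refl

moveBox-ρ : ∀ ν ν′ {i j} → i < j → 0 < ν′ j → BoxMove (shapeOf ν ν′) (shapeOf ν (move ν′ i j))
moveBox-ρ ν ν′ {i} {j} i<j νj>0 = record
  { side = ρ-side ; to = i ; from = j ; to≢from = ℕP.<⇒≢ i<j
  ; gain = move-at-i ν′ i j ; loss = move-loss ν′ i<j νj>0 ; rest = rest }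
  where
  rest : ∀ k → k ≢ (ρ-side , i) → k ≢ (ρ-side , j) → shapeOf ν (move ν′ i j) k ≡ shapeOf ν ν′ k
  rest (σ-side , r) _   _   = refl
  rest (ρ-side , r) r≢i r≢j = move-elsewhere ν′ (λ r≡i → r≢i (cong (ρ-side ,_) r≡i)) (λ r≡j → r≢j (cong (ρ-side ,_) r≡j))

module _ {m n : ℕ} (_⊕_ : Fin m → Fin m → Fin m) (Y : List (Wreath m n)) where

  open Configurations {m} {n} _⊕_ using (ConfigTransitive; ConfigTransitive-cong; step)

  σ-dominance : ∀ ν′ {ν μ} → IsPartition ν → IsPartition μ → size ν ≡ size μ → ν ⊴ μ →
                ConfigTransitive (shapeOf (nth ν) ν′) Y → ConfigTransitive (shapeOf (nth μ) ν′) Y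
  σ-dominance ν′ = ⊴-transport (λ ν → ConfigTransitive (shapeOf ν ν′) Y)
    (λ _ _ ν≗ν″ → ConfigTransitive-cong Y λ { (σ-side , r) → ν≗ν″ r ; (ρ-side , r) → refl })
    (λ ν i<j νj>0 νj≤νi → step (moveBox-σ ν ν′ i<j νj>0) (move-fewer ν i<j νj≤νi) Y)

  ρ-dominance : ∀ ν {ν′ μ′} → IsPartition ν′ → IsPartition μ′ → size ν′ ≡ size μ′ → ν′ ⊴ μ′ →
                ConfigTransitive (shapeOf ν (nth ν′)) Y → ConfigTransitive (shapeOf ν (nth μ′)) Y
  ρ-dominance ν = ⊴-transport (λ ν′ → ConfigTransitive (shapeOf ν ν′) Y)
    (λ _ _ ν′≗ν″ → ConfigTransitive-cong Y λ { (σ-side , r) → refl ; (ρ-side , r) → ν′≗ν″ r })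
    (λ ν′ i<j νj>0 νj≤νi → step (moveBox-ρ ν ν′ i<j νj>0) (move-fewer ν′ i<j νj≤νi) Y)

-- Only the identity element of G is used, as a default label; the rest of the
-- group structure, 0 < n, the case |G| = 1 and the duplicate-freeness of Y are
-- not needed.
lemma5p2 : (m : ℕ) (_⊕_ : Fin m → Fin m → Fin m) (e : Fin m) (neg : Fin m → Fin m) →
    IsAbelianGroup _≡_ _⊕_ e neg →
    (n : ℕ) → 0 < n →
    (σ ρ τ π : List ℕ) →
    IsDoublePartition n σ ρ → IsDoublePartition n τ π →
    (m ≡ 1 → (size ρ ≡ 0) × (size π ≡ 0)) →
    size σ ≡ size τ → σ ⊴ τ → ρ ⊴ π →
    (Y : List (Wreath m n)) → IsSubsetList Y →
    Transitive _⊕_ σ ρ Y → Transitive _⊕_ τ π Y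
lemma5p2 m _⊕_ e _ _ n _ σ ρ τ π (σ↓ , ρ↓ , |σ|+|ρ|≡n) (τ↓ , π↓ , |τ|+|π|≡n) _ |σ|≡|τ| σ⊴τ ρ⊴π Y _ σρ-transitive@(Y≢[] , _) =
  τπ.ConfigTransitive⇒Transitive Y Y≢[]
    (ρ-dominance _⊕_ Y (nth τ) ρ↓ π↓ |ρ|≡|π| ρ⊴π
      (σ-dominance _⊕_ Y (nth ρ) σ↓ τ↓ |σ|≡|τ| σ⊴τ
        (σρ.Transitive⇒ConfigTransitive e Y σρ-transitive)))
  where
  module σρ = Tabloids.DoubleTabloid {m} {n} _⊕_ σ ρ |σ|+|ρ|≡n
  module τπ = Tabloids.DoubleTabloid {m} {n} _⊕_ τ π |τ|+|π|≡n
  |ρ|≡|π| : size ρ ≡ size π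
  |ρ|≡|π| = ℕP.+-cancelˡ-≡ (size σ) (size ρ) (size π) (trans |σ|+|ρ|≡n (trans (sym |τ|+|π|≡n) (cong (ℕ._+ size π) (sym |σ|≡|τ|))))
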